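{- Let $r\ge 2$. Let $U_{n,\ell}^{(r)}$ be the total number of $\mathbf{u}$-steps at level $\ell+1$ over all paths in $\mathcal{A}_{n+1,0}^{(r)}$. Then for all integers $n\ge\ell\ge 0$, $$U_{n,\ell}^{(r)}=\sum_{j=0}^{n-\ell}\binom{n-\ell}{j}\left\{\frac{2\ell+2}{2n-j+2}\binom{2n-j+2}{n-\ell}+\frac{(2\ell+3)(r-1)}{2n-j+3}\binom{2n-j+3}{n-\ell}\right\}(r-1)^{n-j},$$ with $U_{0,0}^{(r)}=r$. Moreover, $U_{n,\ell}^{(r)}$ is the $(n,\ell)$-entry of the Riordan array $\left(S_r(x)^2(1+(r-1)S_r(x)),\ x(r-1)S_r(x)^2\right)$, i.e. $U_{n,\ell}^{(r)}=[x^n]S_r(x)^2(1+(r-1)S_r(x))\left(x(r-1)S_r(x)^2\right)^{\ell}$.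
   Context: A Dyck path of length $2n$ is a lattice path from $(0,0)$ to $(2n,0)$ weakly above the $x$-axis with steps $\mathbf{u}=(1,1)$, $\mathbf{d}=(1,-1)$; an $r$-colored Dyck path has each $\mathbf{d}$-step colored with one of $r$ colors. $\mathcal{A}_{n,0}^{(r)}$ is the set of $r$-colored Dyck paths of length $2n$ with no two consecutive $\mathbf{d}$-steps of the same color. A step is at level $\ell$ if the ordinate of its endpoint is $\ell$. $S_r(x)=\frac{1-x-\sqrt{(1-x)^2-4(r-1)x}}{2(r-1)x}$ is the unique power series with $S_r=1+xS_r+(r-1)xS_r^2$. A Riordan array $(d(x),h(x))$ is the matrix with $(n,k)$-entry $[x^n]d(x)h(x)^k$. -}

module Defs where

open import Data.Nat as ℕ using (ℕ; zero; suc; _∸_; _≤_)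
open import Data.Nat.Combinatorics using (_C_)
open import Data.Integer as ℤ using (ℤ; +_)
open import Data.Rational as ℚ using (ℚ; _/_)
open import Data.Fin using (Fin)
open import Data.Fin.Properties using () renaming (_≟_ to _≟F_)
open import Data.List using (List; []; _∷_; map; concatMap; upTo; allFin; foldr)
open import Data.Nat.ListAction using (sum)
open import Data.Bool using (Bool; true; false; _∧_; if_then_else_; not)
open import Relation.Nullary.Decidable using (⌊_⌋)

-- r-colored Dyck paths, as words over {u} ∪ {d_c | c ∈ Fin r}

data Step (r : ℕ) : Set where
  up   : Step r
  down : Fin r → Step r

alphabet : (r : ℕ) → List (Step r)
alphabet r = up ∷ map down (allFin r)

words : (r m : ℕ) → List (List (Step r))
words r zero    = [] ∷ []
words r (suc m) = concatMap (λ w → map (_∷ w) (alphabet r)) (words r m)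

dyckFrom : ∀ {r} → ℕ → List (Step r) → Bool
dyckFrom zero    []             = true
dyckFrom (suc _) []             = false
dyckFrom h       (up ∷ s)       = dyckFrom (suc h) s
dyckFrom zero    (down _ ∷ s)   = false
dyckFrom (suc h) (down _ ∷ s)   = dyckFrom h s

isDyck : ∀ {r} → List (Step r) → Bool
isDyck = dyckFrom 0

noSameColDD : ∀ {r} → List (Step r) → Bool
noSameColDD []                         = true
noSameColDD (_ ∷ [])                   = true
noSameColDD (down a ∷ down b ∷ s)      = not ⌊ a ≟F b ⌋ ∧ noSameColDD (down b ∷ s)
noSameColDD (down a ∷ up ∷ s)          = noSameColDD (up ∷ s)
noSameColDD (up ∷ t ∷ s)               = noSameColDD (t ∷ s)

inA : ∀ {r} → List (Step r) → Bool
inA p = isDyck p ∧ noSameColDD p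

upsAtFrom : ∀ {r} → ℕ → ℕ → List (Step r) → ℕ
upsAtFrom L h []           = 0
upsAtFrom L h (up ∷ s)     = (if ⌊ suc h ℕ.≟ L ⌋ then 1 else 0) ℕ.+ upsAtFrom L (suc h) s
upsAtFrom L h (down _ ∷ s) = upsAtFrom L (h ∸ 1) s

upsAt : ∀ {r} → ℕ → List (Step r) → ℕ
upsAt L = upsAtFrom L 0

U : (r n ℓ : ℕ) → ℕ
U r n ℓ = sum (map (λ p → if inA p then upsAt (suc ℓ) p else 0)
                   (words r (2 ℕ.* suc n)))

ℕ→ℚ : ℕ → ℚ
ℕ→ℚ k = + k / 1

sumℚ : List ℚ → ℚ
sumℚ = foldr ℚ._+_ (ℚ.0ℚ)

-- summand for index j (0 ≤ j ≤ n - ℓ); 2n-j+2 = suc (suc (2n ∸ j)) since j ≤ n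
formulaTerm : (r n ℓ j : ℕ) → ℚ
formulaTerm r n ℓ j =
  ℕ→ℚ ((n ∸ ℓ) C j) ℚ.*
  ((+ ((2 ℕ.* ℓ ℕ.+ 2) ℕ.* ((suc (suc (2 ℕ.* n ∸ j))) C (n ∸ ℓ))) / suc (suc (2 ℕ.* n ∸ j)))
   ℚ.+ (+ ((2 ℕ.* ℓ ℕ.+ 3) ℕ.* (r ∸ 1) ℕ.* ((suc (suc (suc (2 ℕ.* n ∸ j)))) C (n ∸ ℓ)))
          / suc (suc (suc (2 ℕ.* n ∸ j))))) ℚ.*
  ℕ→ℚ ((r ∸ 1) ℕ.^ (n ∸ j))

formula : (r n ℓ : ℕ) → ℚ
formula r n ℓ = sumℚ (map (formulaTerm r n ℓ) (upTo (suc (n ∸ ℓ))))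

PS : Set
PS = ℕ → ℤ

sumℤ : List ℤ → ℤ
sumℤ = foldr ℤ._+_ (+ 0)

_⊕_ : PS → PS → PS
(f ⊕ g) n = f n ℤ.+ g n

_⊛_ : PS → PS → PS
(f ⊛ g) n = sumℤ (map (λ i → f i ℤ.* g (n ∸ i)) (upTo (suc n)))

const : ℤ → PS
const c zero    = c
const c (suc _) = + 0

xmul : PS → PS
xmul f zero    = + 0
xmul f (suc n) = f n

pow : PS → ℕ → PS
pow f zero    = const (+ 1)
pow f (suc k) = f ⊛ pow f k

-- S is a solution of S = 1 + x S + (r-1) x S² (the unique one: S_r)
IsSr : ℕ → PS → Set
IsSr r S = ∀ n → S n ≡ (const (+ 1) ⊕ (xmul S ⊕ (const (+ (r ∸ 1)) ⊛ xmul (S ⊛ S)))) n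
  where open import Relation.Binary.PropositionalEquality using (_≡_)

riordan : PS → PS → ℕ → ℕ → ℤ
riordan d h n k = (d ⊛ pow h k) n

{-# OPTIONS --safe #-}
-- Write a = r − 1 and P s k = [xˢ] S_r(x)ᵏ. All three claims reduce to U_{ℓ+m,ℓ} = aˡ (P m (2ℓ+2) + a P m (2ℓ+3)).
-- Cutting a path at each of its u-steps at level ℓ+1 expresses U as a convolution of the number of admissible
-- paths from 0 to ℓ with the number of admissible paths from ℓ+1 down to 0, because a u-step separates the
-- runs of d-steps on its two sides. A last-step analysis counts the former as P s (ℓ+1), a first-step analysis
-- counts the latter as aˡ (P q (ℓ+1) + a P q (ℓ+2)), and the convolution of powers of S_r gives the claim. The
-- closed formula then follows from an explicit ballot-number expansion of P, and the Riordan entry from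
-- Sᵏ⁺¹ = Sᵏ + x Sᵏ⁺¹ + a x Sᵏ⁺², which is also the recursion defining P.
module Submission where

open import Data.Nat using (ℕ)

module FiniteSums where

  open import Data.Nat using (ℕ; zero; suc; _+_; _*_; _∸_; _<_; z≤n; s≤s)
  open import Data.Nat.Properties
  open import Data.Nat.Tactic.RingSolver using (solve-∀)
  open import Data.Bool using (Bool; true; false; _∧_; if_then_else_)
  open import Data.Bool.Properties using (∧-zeroʳ)
  open import Data.List using (List; []; _∷_; map; _++_; concatMap)
  import Data.Nat.ListAction as List
  open import Data.Nat.ListAction.Properties using (sum-++)
  open import Data.List.Properties using (map-++)
  open import Data.Fin using (Fin)
  open import Data.Vec.Functional using (Vector)
  open import Algebra.Properties.Semiring.Sum +-*-semiring
    using (sum; ∑-distrib-+; sum-cong-≗; sum-replicate-zero; *-distribʳ-sum) public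
  open import Function using (_∘_)
  open import Relation.Binary.PropositionalEquality

  guard : Bool → ℕ → ℕ
  guard b k = if b then k else 0

  guard-+ : ∀ b u v → guard b (u + v) ≡ guard b u + guard b v
  guard-+ true  u v = refl
  guard-+ false u v = refl

  guard-*ʳ : ∀ b u v → guard b (u * v) ≡ guard b u * v
  guard-*ʳ true  u v = refl
  guard-*ʳ false u v = refl

  guard-comm : ∀ b c k → guard b (guard c k) ≡ guard c (guard b k)
  guard-comm true  c     k = refl
  guard-comm false true  k = refl
  guard-comm false false k = refl

  guard-∧ : ∀ b c k → guard (b ∧ c) k ≡ guard b (guard c k)
  guard-∧ true  c k = refl
  guard-∧ false c k = refl

  guard-∧-middle : ∀ x y z k → guard (x ∧ (y ∧ z)) k ≡ guard y (guard (x ∧ z) k)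
  guard-∧-middle x true  z k = refl
  guard-∧-middle x false z k rewrite ∧-zeroʳ x = refl

  guard-zero : ∀ b → guard b 0 ≡ 0
  guard-zero true  = refl
  guard-zero false = refl

  ∑< : ℕ → (ℕ → ℕ) → ℕ
  ∑< zero    f = 0
  ∑< (suc n) f = f 0 + ∑< n (f ∘ suc)

  syntax ∑< n (λ t → e) = ∑[ t < n ] e

  ∑<-cong : ∀ n {f g : ℕ → ℕ} → (∀ t → t < n → f t ≡ g t) → ∑< n f ≡ ∑< n g
  ∑<-cong zero    eq = refl
  ∑<-cong (suc n) eq = cong₂ _+_ (eq 0 (s≤s z≤n)) (∑<-cong n (λ t t<n → eq (suc t) (s≤s t<n)))

  ∑<-zero : ∀ n (f : ℕ → ℕ) → (∀ t → t < n → f t ≡ 0) → ∑< n f ≡ 0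
  ∑<-zero zero    f f≡0 = refl
  ∑<-zero (suc n) f f≡0 rewrite f≡0 0 (s≤s z≤n) = ∑<-zero n (f ∘ suc) (λ t t<n → f≡0 (suc t) (s≤s t<n))

  ∑<-+ : ∀ n (f g : ℕ → ℕ) → ∑[ t < n ] (f t + g t) ≡ ∑< n f + ∑< n g
  ∑<-+ zero    f g = refl
  ∑<-+ (suc n) f g rewrite ∑<-+ n (f ∘ suc) (g ∘ suc) = interchange (f 0) (g 0) _ _
    where
    interchange : ∀ a b c d → a + b + (c + d) ≡ a + c + (b + d)
    interchange = solve-∀

  ∑<-*ˡ : ∀ n c (f : ℕ → ℕ) → ∑[ t < n ] (c * f t) ≡ c * ∑< n f
  ∑<-*ˡ zero    c f = sym (*-zeroʳ c)
  ∑<-*ˡ (suc n) c f rewrite ∑<-*ˡ n c (f ∘ suc) = sym (*-distribˡ-+ c (f 0) _)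

  ∑<-split : ∀ m n (f : ℕ → ℕ) → ∑< (m + n) f ≡ ∑< m f + ∑[ t < n ] f (m + t)
  ∑<-split zero    n f = refl
  ∑<-split (suc m) n f rewrite ∑<-split m n (f ∘ suc) = sym (+-assoc (f 0) _ _)

  ∑<-last : ∀ n (f : ℕ → ℕ) → ∑< (suc n) f ≡ ∑< n f + f n
  ∑<-last zero    f = +-comm (f 0) 0
  ∑<-last (suc n) f rewrite ∑<-last n (f ∘ suc) = sym (+-assoc (f 0) _ _)

  ∑<-reverse : ∀ n (f : ℕ → ℕ) → ∑< n f ≡ ∑[ t < n ] f (n ∸ suc t)
  ∑<-reverse zero    f = refl
  ∑<-reverse (suc n) f = begin
    f 0 + ∑< n (f ∘ suc)                                     ≡⟨ cong (f 0 +_) (∑<-reverse n (f ∘ suc)) ⟩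
    f 0 + ∑[ t < n ] f (suc (n ∸ suc t))                     ≡⟨ +-comm (f 0) _ ⟩
    ∑[ t < n ] f (suc (n ∸ suc t)) + f 0                     ≡⟨ cong₂ _+_ (∑<-cong n (λ t t<n → cong f (sym (+-∸-assoc 1 t<n))))
                                                                          (cong f (sym (n∸n≡0 n))) ⟩
    ∑[ t < n ] f (suc n ∸ suc t) + f (suc n ∸ suc n)         ≡⟨ ∑<-last n (λ t → f (suc n ∸ suc t)) ⟨
    ∑[ t < suc n ] f (suc n ∸ suc t)                         ∎
    where open ≡-Reasoning

  ∑<-pairs : ∀ n (f : ℕ → ℕ) → ∑< (2 * n) f ≡ ∑[ s < n ] (f (2 * s) + f (suc (2 * s)))
  ∑<-pairs zero    f = refl
  ∑<-pairs (suc n) f = begin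
    ∑< (2 * suc n) f                                              ≡⟨ cong (λ m → ∑< m f) (*-suc 2 n) ⟩
    f 0 + (f 1 + ∑< (2 * n) (f ∘ suc ∘ suc))                      ≡⟨ cong (λ x → f 0 + (f 1 + x)) (∑<-pairs n (f ∘ suc ∘ suc)) ⟩
    f 0 + (f 1 + ∑[ s < n ] (f (2 + 2 * s) + f (3 + 2 * s)))      ≡⟨ +-assoc (f 0) (f 1) _ ⟨
    f 0 + f 1 + ∑[ s < n ] (f (2 + 2 * s) + f (3 + 2 * s))        ≡⟨ cong (f 0 + f 1 +_) (∑<-cong n (λ s _ →
                                                                       cong₂ (λ x y → f x + f y) (sym (*-suc 2 s)) (cong suc (sym (*-suc 2 s))))) ⟩
    ∑[ s < suc n ] (f (2 * s) + f (suc (2 * s)))                  ∎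
    where open ≡-Reasoning

  ∑<-guard : ∀ n b (f : ℕ → ℕ) → ∑[ t < n ] guard b (f t) ≡ guard b (∑< n f)
  ∑<-guard n true  f = refl
  ∑<-guard n false f = ∑<-zero n (λ _ → 0) (λ _ _ → refl)

  ∑<-sum-comm : ∀ m {n} (f : ℕ → Vector ℕ n) → ∑[ t < m ] sum (f t) ≡ sum (λ c → ∑[ t < m ] f t c)
  ∑<-sum-comm zero    {n} f = sym (sum-replicate-zero n)
  ∑<-sum-comm (suc m)     f = trans (cong (sum (f 0) +_) (∑<-sum-comm m (f ∘ suc)))
                                    (sym (∑-distrib-+ (f 0) (λ c → ∑[ t < m ] f (suc t) c)))

  sumOver : {A : Set} → List A → (A → ℕ) → ℕ
  sumOver xs f = List.sum (map f xs)

  sumOver-cong : {A : Set} (xs : List A) {f g : A → ℕ} → (∀ x → f x ≡ g x) → sumOver xs f ≡ sumOver xs g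
  sumOver-cong []       eq = refl
  sumOver-cong (x ∷ xs) eq = cong₂ _+_ (eq x) (sumOver-cong xs eq)

  sumOver-+ : {A : Set} (xs : List A) (f g : A → ℕ) → sumOver xs (λ x → f x + g x) ≡ sumOver xs f + sumOver xs g
  sumOver-+ []       f g = refl
  sumOver-+ (x ∷ xs) f g rewrite sumOver-+ xs f g = interchange (f x) (g x) _ _
    where
    interchange : ∀ a b c d → a + b + (c + d) ≡ a + c + (b + d)
    interchange = solve-∀

  sumOver-*ˡ : {A : Set} (xs : List A) (c : ℕ) (f : A → ℕ) → sumOver xs (λ x → c * f x) ≡ c * sumOver xs f
  sumOver-*ˡ []       c f = sym (*-zeroʳ c)
  sumOver-*ˡ (x ∷ xs) c f rewrite sumOver-*ˡ xs c f = sym (*-distribˡ-+ c (f x) _)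

  sumOver-zero : {A : Set} (xs : List A) → sumOver xs (λ _ → 0) ≡ 0
  sumOver-zero []       = refl
  sumOver-zero (_ ∷ xs) = sumOver-zero xs

  sumOver-guard : {A : Set} (xs : List A) (b : Bool) (f : A → ℕ) → sumOver xs (λ x → guard b (f x)) ≡ guard b (sumOver xs f)
  sumOver-guard xs true  f = refl
  sumOver-guard xs false f = sumOver-zero xs

  sumOver-concatMap : {A B : Set} (g : A → List B) (xs : List A) (f : B → ℕ) →
                      sumOver (concatMap g xs) f ≡ sumOver xs (λ x → sumOver (g x) f)
  sumOver-concatMap g []       f = refl
  sumOver-concatMap g (x ∷ xs) f = begin
    List.sum (map f (g x ++ concatMap g xs))                 ≡⟨ cong List.sum (map-++ f (g x) _) ⟩
    List.sum (map f (g x) ++ map f (concatMap g xs))         ≡⟨ sum-++ (map f (g x)) _ ⟩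
    sumOver (g x) f + sumOver (concatMap g xs) f             ≡⟨ cong (sumOver (g x) f +_) (sumOver-concatMap g xs f) ⟩
    sumOver (g x) f + sumOver xs (λ y → sumOver (g y) f)     ∎
    where open ≡-Reasoning

  sumOver-sum : {A : Set} (xs : List A) {n : ℕ} (f : A → Vector ℕ n) →
                sumOver xs (λ x → sum (f x)) ≡ sum (λ c → sumOver xs (λ x → f x c))
  sumOver-sum []       {n} f = sym (sum-replicate-zero n)
  sumOver-sum (x ∷ xs)     f = trans (cong (sum (f x) +_) (sumOver-sum xs f))
                                     (sym (∑-distrib-+ (f x) (λ c → sumOver xs (λ y → f y c))))

  sum-zero : ∀ n {f : Vector ℕ n} → (∀ c → f c ≡ 0) → sum f ≡ 0
  sum-zero n f≡0 = trans (sum-cong-≗ f≡0) (sum-replicate-zero n)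

module Words where

  open import Defs using (Step; up; down; alphabet; words)
  open import Data.Nat using (ℕ; zero; suc; _+_)
  open import Data.Nat.Properties using (+-comm; +-identityʳ)
  open import Data.List using (List; []; _∷_; map; concatMap; _++_; _∷ʳ_; length; tabulate)
  import Data.Nat.ListAction as List
  open import Data.List.Properties using (map-∘)
  open import Data.Fin using (Fin)
  open import Function using (_∘_)
  open import Relation.Binary.PropositionalEquality
  open FiniteSums

  sumOver-tabulate : ∀ {A : Set} {n} (g : Fin n → A) (f : A → ℕ) → sumOver (tabulate g) f ≡ sum (f ∘ g)
  sumOver-tabulate {n = zero}  g f = refl
  sumOver-tabulate {n = suc n} g f = cong (f (g _) +_) (sumOver-tabulate (g ∘ Fin.suc) f)

  sumOver-map : ∀ {A B : Set} (g : A → B) (xs : List A) (f : B → ℕ) → sumOver (map g xs) f ≡ sumOver xs (f ∘ g)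
  sumOver-map g xs f = cong List.sum (sym (map-∘ xs))

  module WordSums (r : ℕ) where

    sumWords : ℕ → (List (Step r) → ℕ) → ℕ
    sumWords m = sumOver (words r m)

    sumWords-∷ : ∀ m (f : List (Step r) → ℕ) →
      sumWords (suc m) f ≡ sumWords m (λ w → f (up ∷ w)) + sum (λ c → sumWords m (λ w → f (down c ∷ w)))
    sumWords-∷ m f = begin
      sumOver (concatMap (λ w → map (_∷ w) (alphabet r)) (words r m)) f
        ≡⟨ sumOver-concatMap (λ w → map (_∷ w) (alphabet r)) (words r m) f ⟩
      sumWords m (λ w → f (up ∷ w) + sumOver (map (_∷ w) (map down (tabulate (λ c → c)))) f)
        ≡⟨ sumOver-cong (words r m) (λ w → cong (f (up ∷ w) +_) (down-letters w)) ⟩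
      sumWords m (λ w → f (up ∷ w) + sum (λ c → f (down c ∷ w)))
        ≡⟨ sumOver-+ (words r m) (λ w → f (up ∷ w)) (λ w → sum (λ c → f (down c ∷ w))) ⟩
      sumWords m (λ w → f (up ∷ w)) + sumWords m (λ w → sum (λ c → f (down c ∷ w)))
        ≡⟨ cong (sumWords m (λ w → f (up ∷ w)) +_) (sumOver-sum (words r m) (λ w c → f (down c ∷ w))) ⟩
      sumWords m (λ w → f (up ∷ w)) + sum (λ c → sumWords m (λ w → f (down c ∷ w)))
        ∎
      where
      open ≡-Reasoning
      down-letters : ∀ w → sumOver (map (_∷ w) (map down (tabulate (λ c → c)))) f ≡ sum (λ c → f (down c ∷ w))
      down-letters w = trans (sumOver-map (_∷ w) (map down (tabulate (λ c → c))) f)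
                       (trans (sumOver-map down (tabulate (λ c → c)) (f ∘ (_∷ w))) (sumOver-tabulate (λ c → c) (λ c → f (down c ∷ w))))

    sumWords-++ : ∀ m n (f : List (Step r) → ℕ) →
      sumWords (m + n) f ≡ sumWords m (λ u → sumWords n (λ v → f (u ++ v)))
    sumWords-++ zero    n f = +-comm 0 (sumWords n f)
    sumWords-++ (suc m) n f = begin
      sumWords (suc (m + n)) f
        ≡⟨ sumWords-∷ (m + n) f ⟩
      sumWords (m + n) (λ w → f (up ∷ w)) + sum (λ c → sumWords (m + n) (λ w → f (down c ∷ w)))
        ≡⟨ cong₂ _+_ (sumWords-++ m n (λ w → f (up ∷ w)))
                     (sum-cong-≗ (λ c → sumWords-++ m n (λ w → f (down c ∷ w)))) ⟩
      sumWords m (λ u → g (up ∷ u)) + sum (λ c → sumWords m (λ u → g (down c ∷ u)))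
        ≡⟨ sumWords-∷ m g ⟨
      sumWords (suc m) g
        ∎
      where
      open ≡-Reasoning
      g : List (Step r) → ℕ
      g u = sumWords n (λ v → f (u ++ v))

    sumWords-∷ʳ : ∀ m (f : List (Step r) → ℕ) →
      sumWords (suc m) f ≡ sumWords m (λ w → f (w ∷ʳ up)) + sum (λ c → sumWords m (λ w → f (w ∷ʳ down c)))
    sumWords-∷ʳ m f = begin
      sumWords (suc m) f
        ≡⟨ cong (λ k → sumWords k f) (+-comm 1 m) ⟩
      sumWords (m + 1) f
        ≡⟨ sumWords-++ m 1 f ⟩
      sumWords m (λ u → sumWords 1 (λ v → f (u ++ v)))
        ≡⟨ sumOver-cong (words r m) (λ u → sumWords-∷ 0 (λ v → f (u ++ v))) ⟩
      sumWords m (λ w → f (w ∷ʳ up) + 0 + sum (λ c → f (w ∷ʳ down c) + 0))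
        ≡⟨ sumOver-cong (words r m) (λ w → cong₂ _+_ (+-identityʳ (f (w ∷ʳ up))) (sum-cong-≗ (λ c → +-identityʳ (f (w ∷ʳ down c))))) ⟩
      sumWords m (λ w → f (w ∷ʳ up) + sum (λ c → f (w ∷ʳ down c)))
        ≡⟨ sumOver-+ (words r m) (λ w → f (w ∷ʳ up)) (λ w → sum (λ c → f (w ∷ʳ down c))) ⟩
      sumWords m (λ w → f (w ∷ʳ up)) + sumWords m (λ w → sum (λ c → f (w ∷ʳ down c)))
        ≡⟨ cong (sumWords m (λ w → f (w ∷ʳ up)) +_) (sumOver-sum (words r m) (λ w c → f (w ∷ʳ down c))) ⟩
      sumWords m (λ w → f (w ∷ʳ up)) + sum (λ c → sumWords m (λ w → f (w ∷ʳ down c)))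
        ∎
      where open ≡-Reasoning

    sumWords-cong-length : ∀ m {f g : List (Step r) → ℕ} →
      (∀ w → length w ≡ m → f w ≡ g w) → sumWords m f ≡ sumWords m g
    sumWords-cong-length zero        eq = cong (_+ 0) (eq [] refl)
    sumWords-cong-length (suc m) {f} {g} eq = begin
      sumWords (suc m) f
        ≡⟨ sumWords-∷ m f ⟩
      sumWords m (λ w → f (up ∷ w)) + sum (λ c → sumWords m (λ w → f (down c ∷ w)))
        ≡⟨ cong₂ _+_ (sumWords-cong-length m (λ w ∣w∣≡m → eq (up ∷ w) (cong suc ∣w∣≡m)))
                     (sum-cong-≗ (λ c → sumWords-cong-length m (λ w ∣w∣≡m → eq (down c ∷ w) (cong suc ∣w∣≡m)))) ⟩
      sumWords m (λ w → g (up ∷ w)) + sum (λ c → sumWords m (λ w → g (down c ∷ w)))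
        ≡⟨ sumWords-∷ m g ⟨
      sumWords (suc m) g
        ∎
      where open ≡-Reasoning

module Coefficients (a : ℕ) where

  open import Data.Nat using (ℕ; zero; suc; _+_; _*_; _∸_; _≤_)
  open import Data.Nat.Properties
  open import Data.Nat.Tactic.RingSolver using (solve-∀)
  open import Relation.Binary.PropositionalEquality
  open FiniteSums

  -- P s k = [xˢ] S(x)ᵏ for S = S_{a+1}: multiplying S = 1 + x S + a x S² by Sᵏ gives
  -- Sᵏ⁺¹ = Sᵏ + x Sᵏ⁺¹ + a x Sᵏ⁺².
  P : ℕ → ℕ → ℕ
  P zero    k       = 1
  P (suc s) zero    = 0
  P (suc s) (suc k) = P (suc s) k + P s (suc k) + a * P s (suc (suc k))

  Q : ℕ → ℕ → ℕ
  Q s k = P s k + a * P s (suc k)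

  ΔP : ℕ → ℕ → ℕ
  ΔP zero    k = 0
  ΔP (suc s) k = Q s (suc k)

  P-suc : ∀ s k → P s (suc k) ≡ P s k + ΔP s k
  P-suc zero    k = refl
  P-suc (suc s) k = +-assoc (P (suc s) k) (P s (suc k)) _

  P-convolution-sum : ℕ → ℕ → ℕ → ℕ
  P-convolution-sum k₁ m k₂ = ∑[ s < suc m ] (P s k₁ * P (m ∸ s) k₂)

  private
    P-unfold : ∀ m s k → s ≤ m →
               P (suc m ∸ s) (suc k) ≡ P (suc m ∸ s) k + P (m ∸ s) (suc k) + a * P (m ∸ s) (suc (suc k))
    P-unfold m s k s≤m rewrite +-∸-assoc 1 s≤m = refl

    convolution-step : ∀ k₁ m k₂ →
      P-convolution-sum k₁ (suc m) (suc k₂)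
        ≡ P-convolution-sum k₁ (suc m) k₂ + P-convolution-sum k₁ m (suc k₂) + a * P-convolution-sum k₁ m (suc (suc k₂))
    convolution-step k₁ m k₂ = begin
      P-convolution-sum k₁ (suc m) (suc k₂)
        ≡⟨ ∑<-last (suc m) (λ s → P s k₁ * P (suc m ∸ s) (suc k₂)) ⟩
      ∑[ s < suc m ] (P s k₁ * P (suc m ∸ s) (suc k₂)) + P (suc m) k₁ * P (m ∸ m) (suc k₂)
        ≡⟨ cong₂ _+_ (∑<-cong (suc m) (λ s s<m → cong (P s k₁ *_) (P-unfold m s k₂ (≤-pred s<m))))
                     (cong (λ z → P (suc m) k₁ * P z (suc k₂)) (n∸n≡0 m)) ⟩
      ∑[ s < suc m ] (P s k₁ * (X s + Y s + a * Z s)) + P (suc m) k₁ * 1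
        ≡⟨ cong (_+ P (suc m) k₁ * 1) expand ⟩
      ∑[ s < suc m ] (P s k₁ * X s) + Ys + a * Zs + P (suc m) k₁ * 1
        ≡⟨ move-last a (∑[ s < suc m ] (P s k₁ * X s)) Ys Zs (P (suc m) k₁ * 1) ⟩
      ∑[ s < suc m ] (P s k₁ * X s) + P (suc m) k₁ * 1 + Ys + a * Zs
        ≡⟨ cong (λ z → ∑[ s < suc m ] (P s k₁ * X s) + P (suc m) k₁ * P z k₂ + Ys + a * Zs) (n∸n≡0 m) ⟨
      ∑[ s < suc m ] (P s k₁ * X s) + P (suc m) k₁ * P (m ∸ m) k₂ + Ys + a * Zs
        ≡⟨ cong (λ z → z + Ys + a * Zs) (∑<-last (suc m) (λ s → P s k₁ * X s)) ⟨
      P-convolution-sum k₁ (suc m) k₂ + Ys + a * Zs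
        ∎
      where
      open ≡-Reasoning
      X Y Z : ℕ → ℕ
      X s = P (suc m ∸ s) k₂
      Y s = P (m ∸ s) (suc k₂)
      Z s = P (m ∸ s) (suc (suc k₂))
      Ys = P-convolution-sum k₁ m (suc k₂)
      Zs = P-convolution-sum k₁ m (suc (suc k₂))
      distribute : ∀ c p x y z → p * (x + y + c * z) ≡ p * x + p * y + c * (p * z)
      distribute = solve-∀
      move-last : ∀ c x y z w → x + y + c * z + w ≡ x + w + y + c * z
      move-last = solve-∀
      expand : ∑[ s < suc m ] (P s k₁ * (X s + Y s + a * Z s)) ≡ ∑[ s < suc m ] (P s k₁ * X s) + Ys + a * Zs
      expand = begin
        ∑[ s < suc m ] (P s k₁ * (X s + Y s + a * Z s))
          ≡⟨ ∑<-cong (suc m) (λ s _ → distribute a (P s k₁) (X s) (Y s) (Z s)) ⟩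
        ∑[ s < suc m ] (P s k₁ * X s + P s k₁ * Y s + a * (P s k₁ * Z s))
          ≡⟨ ∑<-+ (suc m) (λ s → P s k₁ * X s + P s k₁ * Y s) (λ s → a * (P s k₁ * Z s)) ⟩
        ∑[ s < suc m ] (P s k₁ * X s + P s k₁ * Y s) + ∑[ s < suc m ] (a * (P s k₁ * Z s))
          ≡⟨ cong₂ _+_ (∑<-+ (suc m) (λ s → P s k₁ * X s) (λ s → P s k₁ * Y s)) (∑<-*ˡ (suc m) a (λ s → P s k₁ * Z s)) ⟩
        ∑[ s < suc m ] (P s k₁ * X s) + Ys + a * Zs
          ∎

  P-convolution : ∀ k₁ m k₂ → P-convolution-sum k₁ m k₂ ≡ P m (k₁ + k₂)
  P-convolution k₁ zero    k₂       = refl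
  P-convolution k₁ (suc m) zero     = begin
    P-convolution-sum k₁ (suc m) 0
      ≡⟨ ∑<-last (suc m) (λ s → P s k₁ * P (suc m ∸ s) 0) ⟩
    ∑[ s < suc m ] (P s k₁ * P (suc m ∸ s) 0) + P (suc m) k₁ * P (m ∸ m) 0
      ≡⟨ cong₂ _+_ (∑<-zero (suc m) (λ s → P s k₁ * P (suc m ∸ s) 0) (λ s s<m → trans (cong (P s k₁ *_) (P-suc∸-zero s (≤-pred s<m))) (*-zeroʳ (P s k₁))))
                   (cong (λ z → P (suc m) k₁ * P z 0) (n∸n≡0 m)) ⟩
    P (suc m) k₁ * 1
      ≡⟨ *-identityʳ _ ⟩
    P (suc m) k₁
      ≡⟨ cong (P (suc m)) (+-identityʳ k₁) ⟨
    P (suc m) (k₁ + 0)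
      ∎
    where
    open ≡-Reasoning
    P-suc∸-zero : ∀ s → s ≤ m → P (suc m ∸ s) 0 ≡ 0
    P-suc∸-zero s s≤m rewrite +-∸-assoc 1 s≤m = refl
  P-convolution k₁ (suc m) (suc k₂) = begin
    P-convolution-sum k₁ (suc m) (suc k₂)
      ≡⟨ convolution-step k₁ m k₂ ⟩
    P-convolution-sum k₁ (suc m) k₂ + P-convolution-sum k₁ m (suc k₂) + a * P-convolution-sum k₁ m (suc (suc k₂))
      ≡⟨ cong₂ _+_ (cong₂ _+_ (P-convolution k₁ (suc m) k₂) (P-convolution k₁ m (suc k₂)))
                   (cong (a *_) (P-convolution k₁ m (suc (suc k₂)))) ⟩
    P (suc m) (k₁ + k₂) + P m (k₁ + suc k₂) + a * P m (k₁ + suc (suc k₂))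
      ≡⟨ cong₂ (λ x y → P (suc m) (k₁ + k₂) + P m x + a * P m y) (+-suc k₁ k₂) (trans (+-suc k₁ (suc k₂)) (cong suc (+-suc k₁ k₂))) ⟩
    P (suc m) (suc (k₁ + k₂))
      ≡⟨ cong (P (suc m)) (+-suc k₁ k₂) ⟨
    P (suc m) (k₁ + suc k₂)
      ∎
    where open ≡-Reasoning

  Q-convolution : ∀ k₁ m k₂ → ∑[ s < suc m ] (P s k₁ * Q (m ∸ s) k₂) ≡ Q m (k₁ + k₂)
  Q-convolution k₁ m k₂ = begin
    ∑[ s < suc m ] (P s k₁ * Q (m ∸ s) k₂)
      ≡⟨ ∑<-cong (suc m) (λ s _ → distribute a (P s k₁) (P (m ∸ s) k₂) (P (m ∸ s) (suc k₂))) ⟩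
    ∑[ s < suc m ] (P s k₁ * P (m ∸ s) k₂ + a * (P s k₁ * P (m ∸ s) (suc k₂)))
      ≡⟨ ∑<-+ (suc m) (λ s → P s k₁ * P (m ∸ s) k₂) (λ s → a * (P s k₁ * P (m ∸ s) (suc k₂))) ⟩
    P-convolution-sum k₁ m k₂ + ∑[ s < suc m ] (a * (P s k₁ * P (m ∸ s) (suc k₂)))
      ≡⟨ cong (P-convolution-sum k₁ m k₂ +_) (∑<-*ˡ (suc m) a (λ s → P s k₁ * P (m ∸ s) (suc k₂))) ⟩
    P-convolution-sum k₁ m k₂ + a * P-convolution-sum k₁ m (suc k₂)
      ≡⟨ cong₂ (λ x y → x + a * y) (P-convolution k₁ m k₂) (trans (P-convolution k₁ m (suc k₂)) (cong (P m) (+-suc k₁ k₂))) ⟩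
    Q m (k₁ + k₂)
      ∎
    where
    open ≡-Reasoning
    distribute : ∀ c p x y → p * (x + c * y) ≡ p * x + c * (p * y)
    distribute = solve-∀

module ColouredPaths (a : ℕ) where

  open import Defs using (Step; up; down; words; dyckFrom; noSameColDD; upsAtFrom; U)
  open import Data.Nat using (ℕ; zero; suc; _+_; _*_; _∸_; _^_; _<_; _≤_; _≟_; s≤s)
  open import Data.Nat.Properties
  open import Data.Nat.Tactic.RingSolver using (solve-∀)
  open import Data.Fin using (Fin) renaming (zero to fzero; suc to fsuc)
  open import Data.Fin.Properties using () renaming (_≟_ to _≟ᶠ_)
  import Data.Fin.Properties
  open import Data.Bool using (Bool; true; false; _∧_; not)
  open import Data.Bool.Properties using (∧-zeroʳ; ∧-identityʳ; ∧-assoc)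
  open import Data.List using (List; []; _∷_; _∷ʳ_; length)
  open import Data.Product using (∃; _,_)
  open import Data.Empty using (⊥; ⊥-elim)
  open import Function using (_∘_; _∘′_)
  open import Relation.Nullary using (yes; no)
  open import Relation.Nullary.Decidable using (⌊_⌋)
  open import Relation.Binary.PropositionalEquality
  open FiniteSums
  open Words
  open Coefficients a
  open WordSums (suc a)

  ≟-true : ∀ {h j} → ⌊ h ≟ j ⌋ ≡ true → h ≡ j
  ≟-true {h} {j} e with h ≟ j
  ≟-true e  | yes h≡j = h≡j
  ≟-true () | no _

  ≟-suc : ∀ h j → ⌊ suc h ≟ suc j ⌋ ≡ ⌊ h ≟ j ⌋
  ≟-suc h j with h ≟ j | suc h ≟ suc j
  ... | yes _    | yes _ = refl
  ... | yes refl | no ≢  = ⊥-elim (≢ refl)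
  ... | no ≢     | yes e = ⊥-elim (≢ (suc-injective e))
  ... | no _     | no _  = refl

  sum-const : ∀ n k → sum {n} (λ _ → k) ≡ n * k
  sum-const zero    k = refl
  sum-const (suc n) k = cong (k +_) (sum-const n k)

  sum-≢ : ∀ n (b : Fin (suc n)) k → sum (λ c → guard (not ⌊ b ≟ᶠ c ⌋) k) ≡ n * k
  sum-≢ n       fzero    k = sum-const n k
  sum-≢ (suc n) (fsuc b) k = cong (k +_) (trans (sum-cong-≗ (λ c → cong (λ x → guard (not x) k) (≟ᶠ-suc b c))) (sum-≢ n b k))
    where
    ≟ᶠ-suc : ∀ {n} (b c : Fin n) → ⌊ fsuc b ≟ᶠ fsuc c ⌋ ≡ ⌊ b ≟ᶠ c ⌋
    ≟ᶠ-suc b c with b ≟ᶠ c | fsuc b ≟ᶠ fsuc c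
    ... | yes _    | yes _ = refl
    ... | yes refl | no ≢  = ⊥-elim (≢ refl)
    ... | no ≢     | yes e = ⊥-elim (≢ (Data.Fin.Properties.suc-injective e))
    ... | no _     | no _  = refl

  Walk : Set
  Walk = List (Step (suc a))

  isPath : ℕ → Walk → ℕ → Bool
  isPath h       []           j = ⌊ h ≟ j ⌋
  isPath h       (up ∷ w)     j = isPath (suc h) w j
  isPath zero    (down _ ∷ w) j = false
  isPath (suc h) (down _ ∷ w) j = isPath h w j

  dyckFrom≡isPath : ∀ h (w : Walk) → dyckFrom h w ≡ isPath h w 0
  dyckFrom≡isPath zero    []           = refl
  dyckFrom≡isPath (suc h) []           = refl
  dyckFrom≡isPath zero    (up ∷ w)     = dyckFrom≡isPath 1 w
  dyckFrom≡isPath (suc h) (up ∷ w)     = dyckFrom≡isPath (suc (suc h)) w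
  dyckFrom≡isPath zero    (down _ ∷ w) = refl
  dyckFrom≡isPath (suc h) (down _ ∷ w) = dyckFrom≡isPath h w

  isPath-descent : ∀ h w j → isPath h w j ≡ true → h ≤ j + length w
  isPath-descent h       []           j e = ≤-reflexive (trans (≟-true e) (sym (+-identityʳ j)))
  isPath-descent h       (up ∷ w)     j e = ≤-trans (n≤1+n h) (≤-trans (isPath-descent (suc h) w j e) (+-monoʳ-≤ j (n≤1+n _)))
  isPath-descent (suc h) (down _ ∷ w) j e = ≤-trans (s≤s (isPath-descent h w j e)) (≤-reflexive (sym (+-suc j (length w))))

  isPath-ascent : ∀ h w j → isPath h w j ≡ true → j ≤ h + length w
  isPath-ascent h       []           j e = ≤-reflexive (trans (sym (≟-true e)) (sym (+-identityʳ h)))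
  isPath-ascent h       (up ∷ w)     j e = ≤-trans (isPath-ascent (suc h) w j e) (≤-reflexive (sym (+-suc h (length w))))
  isPath-ascent (suc h) (down _ ∷ w) j e = ≤-trans (isPath-ascent h w j e) (≤-trans (n≤1+n _) (s≤s (+-monoʳ-≤ h (n≤1+n _))))

  isPath-parity : ∀ h w j → isPath h w j ≡ true → ∃ λ d → h + length w ≡ j + 2 * d
  isPath-parity h       []           j e = 0 , trans (+-identityʳ h) (trans (≟-true e) (sym (+-identityʳ j)))
  isPath-parity h       (up ∷ w)     j e with isPath-parity (suc h) w j e
  ... | d , eq = d , trans (+-suc h (length w)) eq
  isPath-parity (suc h) (down _ ∷ w) j e with isPath-parity h w j e
  ... | d , eq = suc d , (begin
    suc (h + suc (length w))  ≡⟨ cong suc (+-suc h (length w)) ⟩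
    suc (suc (h + length w))  ≡⟨ cong (suc ∘′ suc) eq ⟩
    suc (suc (j + 2 * d))     ≡⟨ cong suc (+-suc j (2 * d)) ⟨
    suc (j + suc (2 * d))     ≡⟨ +-suc j (suc (2 * d)) ⟨
    j + suc (suc (2 * d))     ≡⟨ cong (j +_) (*-suc 2 d) ⟨
    j + 2 * suc d             ∎)
    where
    open ≡-Reasoning

  isPath-∷ʳ-up : ∀ h w j → isPath h (w ∷ʳ up) (suc j) ≡ isPath h w j
  isPath-∷ʳ-up h       []           j = ≟-suc h j
  isPath-∷ʳ-up h       (up ∷ w)     j = isPath-∷ʳ-up (suc h) w j
  isPath-∷ʳ-up zero    (down _ ∷ w) j = refl
  isPath-∷ʳ-up (suc h) (down _ ∷ w) j = isPath-∷ʳ-up h w j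

  isPath-∷ʳ-up-ground : ∀ h w → isPath h (w ∷ʳ up) 0 ≡ false
  isPath-∷ʳ-up-ground h       []           = refl
  isPath-∷ʳ-up-ground h       (up ∷ w)     = isPath-∷ʳ-up-ground (suc h) w
  isPath-∷ʳ-up-ground zero    (down _ ∷ w) = refl
  isPath-∷ʳ-up-ground (suc h) (down _ ∷ w) = isPath-∷ʳ-up-ground h w

  isPath-∷ʳ-down : ∀ h w c j → isPath h (w ∷ʳ down c) j ≡ isPath h w (suc j)
  isPath-∷ʳ-down zero    []           c j = refl
  isPath-∷ʳ-down (suc h) []           c j = sym (≟-suc h j)
  isPath-∷ʳ-down h       (up ∷ w)     c j = isPath-∷ʳ-down (suc h) w c j
  isPath-∷ʳ-down zero    (down _ ∷ w) c j = refl
  isPath-∷ʳ-down (suc h) (down _ ∷ w) c j = isPath-∷ʳ-down h w c j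

  noSameColDD-up∷ : ∀ (w : Walk) → noSameColDD (up ∷ w) ≡ noSameColDD w
  noSameColDD-up∷ []      = refl
  noSameColDD-up∷ (_ ∷ _) = refl

  compatible : Step (suc a) → Step (suc a) → Bool
  compatible (down c) (down d) = not ⌊ c ≟ᶠ d ⌋
  compatible (down c) up       = true
  compatible up       t        = true

  noSameColDD-∷∷ : ∀ s t w → noSameColDD (s ∷ t ∷ w) ≡ compatible s t ∧ noSameColDD (t ∷ w)
  noSameColDD-∷∷ up       t        w = refl
  noSameColDD-∷∷ (down c) up       w = refl
  noSameColDD-∷∷ (down c) (down d) w = refl

  choices : Step (suc a) → ℕ
  choices up       = suc a
  choices (down _) = a

  sum-compatible : ∀ s k → sum (λ c → guard (compatible s (down c)) k) ≡ choices s * k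
  sum-compatible up       k = sum-const (suc a) k
  sum-compatible (down b) k = sum-≢ a b k

  last : Step (suc a) → Walk → Step (suc a)
  last s []      = s
  last s (t ∷ w) = last t w

  last-∷ʳ : ∀ s w t → last s (w ∷ʳ t) ≡ t
  last-∷ʳ s []      t = refl
  last-∷ʳ s (x ∷ w) t = last-∷ʳ x w t

  noSameColDD-∷ʳ : ∀ s w t → noSameColDD (s ∷ w ∷ʳ t) ≡ noSameColDD (s ∷ w) ∧ compatible (last s w) t
  noSameColDD-∷ʳ s []      t = trans (noSameColDD-∷∷ s t []) (∧-identityʳ _)
  noSameColDD-∷ʳ s (x ∷ w) t = begin
    noSameColDD (s ∷ x ∷ w ∷ʳ t)                                   ≡⟨ noSameColDD-∷∷ s x (w ∷ʳ t) ⟩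
    compatible s x ∧ noSameColDD (x ∷ w ∷ʳ t)                      ≡⟨ cong (compatible s x ∧_) (noSameColDD-∷ʳ x w t) ⟩
    compatible s x ∧ (noSameColDD (x ∷ w) ∧ compatible (last x w) t)  ≡⟨ ∧-assoc (compatible s x) _ _ ⟨
    (compatible s x ∧ noSameColDD (x ∷ w)) ∧ compatible (last x w) t  ≡⟨ cong (_∧ compatible (last x w) t) (noSameColDD-∷∷ s x w) ⟨
    noSameColDD (s ∷ x ∷ w) ∧ compatible (last x w) t              ∎
    where open ≡-Reasoning

  admissible : Step (suc a) → ℕ → ℕ → Walk → Bool
  admissible s h j w = isPath h w j ∧ noSameColDD (s ∷ w)

  -- s is the step preceding w: it only enters through the colour condition at the junction.
  paths : Step (suc a) → ℕ → ℕ → ℕ → ℕ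
  paths s m h j = sumWords m (λ w → guard (admissible s h j w) 1)

  levelUps : ℕ → Step (suc a) → ℕ → ℕ → ℕ
  levelUps L s m h = sumWords m (λ w → guard (admissible s h 0 w) (upsAtFrom L h w))

  paths-vanish : ∀ s m h j → (∀ w → length w ≡ m → isPath h w j ≡ true → ⊥) → paths s m h j ≡ 0
  paths-vanish s m h j no-path = trans (sumWords-cong-length m vanish) (sumOver-zero (words (suc a) m))
    where
    vanish : ∀ w → length w ≡ m → guard (admissible s h j w) 1 ≡ 0
    vanish w ∣w∣≡m with isPath h w j in e
    ... | true  = ⊥-elim (no-path w ∣w∣≡m e)
    ... | false = refl

  noSameColDD-∷up : ∀ s (w : Walk) → noSameColDD (s ∷ up ∷ w) ≡ noSameColDD (up ∷ w)
  noSameColDD-∷up up       w = refl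
  noSameColDD-∷up (down c) w = refl

  private
    upFirst : ∀ (g : Walk → ℕ) s m h j →
      sumWords m (λ w → guard (admissible s h j (up ∷ w)) (g (up ∷ w)))
        ≡ sumWords m (λ w → guard (admissible up (suc h) j w) (g (up ∷ w)))
    upFirst g s m h j = sumOver-cong (words (suc a) m)
      (λ w → cong (λ b → guard (isPath (suc h) w j ∧ b) (g (up ∷ w))) (noSameColDD-∷up s w))

  firstStep-ground : ∀ (g : Walk → ℕ) s m j →
    sumWords (suc m) (λ w → guard (admissible s 0 j w) (g w))
      ≡ sumWords m (λ w → guard (admissible up 1 j w) (g (up ∷ w)))
  firstStep-ground g s m j = begin
    sumWords (suc m) (λ w → guard (admissible s 0 j w) (g w))
      ≡⟨ sumWords-∷ m (λ w → guard (admissible s 0 j w) (g w)) ⟩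
    sumWords m (λ w → guard (admissible s 0 j (up ∷ w)) (g (up ∷ w))) + sum {suc a} (λ _ → sumWords m (λ _ → 0))
      ≡⟨ cong₂ _+_ (upFirst g s m 0 j) (sum-zero (suc a) (λ _ → sumOver-zero (words (suc a) m))) ⟩
    sumWords m (λ w → guard (admissible up 1 j w) (g (up ∷ w))) + 0
      ≡⟨ +-identityʳ _ ⟩
    sumWords m (λ w → guard (admissible up 1 j w) (g (up ∷ w)))
      ∎
    where open ≡-Reasoning

  firstStep : ∀ (g : Walk → ℕ) s m h j →
    sumWords (suc m) (λ w → guard (admissible s (suc h) j w) (g w))
      ≡ sumWords m (λ w → guard (admissible up (suc (suc h)) j w) (g (up ∷ w)))
        + sum (λ c → guard (compatible s (down c)) (sumWords m (λ w → guard (admissible (down c) h j w) (g (down c ∷ w)))))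
  firstStep g s m h j = begin
    sumWords (suc m) (λ w → guard (admissible s (suc h) j w) (g w))
      ≡⟨ sumWords-∷ m (λ w → guard (admissible s (suc h) j w) (g w)) ⟩
    sumWords m (λ w → guard (admissible s (suc h) j (up ∷ w)) (g (up ∷ w)))
      + sum (λ c → sumWords m (λ w → guard (admissible s (suc h) j (down c ∷ w)) (g (down c ∷ w))))
      ≡⟨ cong₂ _+_ (upFirst g s m (suc h) j) (sum-cong-≗ downFirst) ⟩
    sumWords m (λ w → guard (admissible up (suc (suc h)) j w) (g (up ∷ w)))
      + sum (λ c → guard (compatible s (down c)) (sumWords m (λ w → guard (admissible (down c) h j w) (g (down c ∷ w)))))
      ∎
    where
    open ≡-Reasoning
    downFirst : ∀ c → sumWords m (λ w → guard (admissible s (suc h) j (down c ∷ w)) (g (down c ∷ w)))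
                    ≡ guard (compatible s (down c)) (sumWords m (λ w → guard (admissible (down c) h j w) (g (down c ∷ w))))
    downFirst c = trans (sumOver-cong (words (suc a) m) (λ w → trans
                    (cong (λ b → guard (isPath h w j ∧ b) (g (down c ∷ w))) (noSameColDD-∷∷ s (down c) w))
                    (guard-∧-middle (isPath h w j) (compatible s (down c)) _ _)))
                  (sumOver-guard (words (suc a) m) (compatible s (down c)) _)

  paths-zero : ∀ s h j → paths s 0 h j ≡ guard ⌊ h ≟ j ⌋ 1
  paths-zero s h j = trans (+-identityʳ _) (cong (λ b → guard b 1) (∧-identityʳ _))

  paths-suc-ground : ∀ s m j → paths s (suc m) 0 j ≡ paths up m 1 j
  paths-suc-ground s m j = firstStep-ground (λ _ → 1) s m j

  paths-suc : ∀ s m h j →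
    paths s (suc m) (suc h) j ≡ paths up m (suc (suc h)) j + sum (λ c → guard (compatible s (down c)) (paths (down c) m h j))
  paths-suc s m h j = firstStep (λ _ → 1) s m h j

  levelUps-zero : ∀ L s h → levelUps L s 0 h ≡ 0
  levelUps-zero L s h = trans (+-identityʳ _) (guard-zero _)

  private
    upStep : ∀ L m h →
      sumWords m (λ w → guard (admissible up (suc h) 0 w) (upsAtFrom L h (up ∷ w)))
        ≡ guard ⌊ suc h ≟ L ⌋ (paths up m (suc h) 0) + levelUps L up m (suc h)
    upStep L m h = begin
      sumWords m (λ w → guard (A w) (guard b 1 + upsAtFrom L (suc h) w))
        ≡⟨ sumOver-cong (words (suc a) m) (λ w → trans (guard-+ (A w) (guard b 1) _) (cong (_+ guard (A w) (upsAtFrom L (suc h) w)) (guard-comm (A w) b 1))) ⟩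
      sumWords m (λ w → guard b (guard (A w) 1) + guard (A w) (upsAtFrom L (suc h) w))
        ≡⟨ sumOver-+ (words (suc a) m) (λ w → guard b (guard (A w) 1)) (λ w → guard (A w) (upsAtFrom L (suc h) w)) ⟩
      sumWords m (λ w → guard b (guard (A w) 1)) + levelUps L up m (suc h)
        ≡⟨ cong (_+ levelUps L up m (suc h)) (sumOver-guard (words (suc a) m) b (λ w → guard (A w) 1)) ⟩
      guard b (paths up m (suc h) 0) + levelUps L up m (suc h)
        ∎
      where
      open ≡-Reasoning
      b = ⌊ suc h ≟ L ⌋
      A = admissible up (suc h) 0

  levelUps-suc-ground : ∀ L s m → levelUps L s (suc m) 0 ≡ guard ⌊ 1 ≟ L ⌋ (paths up m 1 0) + levelUps L up m 1
  levelUps-suc-ground L s m = trans (firstStep-ground (upsAtFrom L 0) s m 0) (upStep L m 0)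

  levelUps-suc : ∀ L s m h →
    levelUps L s (suc m) (suc h)
      ≡ guard ⌊ suc (suc h) ≟ L ⌋ (paths up m (suc (suc h)) 0) + levelUps L up m (suc (suc h))
        + sum (λ c → guard (compatible s (down c)) (levelUps L (down c) m h))
  levelUps-suc L s m h = trans (firstStep (upsAtFrom L (suc h)) s m h 0) (cong (_+ sum (λ c → guard (compatible s (down c)) (levelUps L (down c) m h))) (upStep L m (suc h)))

  isDown : Step (suc a) → Bool
  isDown up       = false
  isDown (down _) = true

  pathsEndingUp pathsEndingDown : ℕ → ℕ → ℕ
  pathsEndingUp   m j = sumWords m (λ w → guard (admissible up 0 j w ∧ not (isDown (last up w))) 1)
  pathsEndingDown m j = sumWords m (λ w → guard (admissible up 0 j w ∧ isDown (last up w)) 1)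

  paths-by-last : ∀ m j → paths up m 0 j ≡ pathsEndingUp m j + pathsEndingDown m j
  paths-by-last m j = trans (sumOver-cong (words (suc a) m) (λ w → split (admissible up 0 j w) (isDown (last up w))))
                            (sumOver-+ (words (suc a) m) _ _)
    where
    split : ∀ b d → guard b 1 ≡ guard (b ∧ not d) 1 + guard (b ∧ d) 1
    split true  true  = refl
    split true  false = refl
    split false d     = refl

  compatible-up : ∀ s → compatible s up ≡ true
  compatible-up up       = refl
  compatible-up (down _) = refl

  private
    lastUp : ∀ w j → admissible up 0 j (w ∷ʳ up) ∧ isDown (last up (w ∷ʳ up)) ≡ false
    lastUp w j rewrite last-∷ʳ up w up = ∧-zeroʳ _

    lastDown : ∀ w c j → admissible up 0 j (w ∷ʳ down c) ∧ not (isDown (last up (w ∷ʳ down c))) ≡ false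
    lastDown w c j rewrite last-∷ʳ up w (down c) = ∧-zeroʳ _

    lastDown-admissible : ∀ w c j →
      guard (admissible up 0 j (w ∷ʳ down c) ∧ isDown (last up (w ∷ʳ down c))) 1
        ≡ guard (compatible (last up w) (down c)) (guard (admissible up 0 (suc j) w) 1)
    lastDown-admissible w c j
      rewrite isPath-∷ʳ-down 0 w c j | noSameColDD-∷ʳ up w (down c) | last-∷ʳ up w (down c) = begin
      guard ((x ∧ (y ∧ z)) ∧ true) 1  ≡⟨ cong (λ b → guard b 1) (trans (∧-identityʳ _) (sym (∧-assoc x y z))) ⟩
      guard ((x ∧ y) ∧ z) 1           ≡⟨ guard-∧ (x ∧ y) z 1 ⟩
      guard (x ∧ y) (guard z 1)       ≡⟨ guard-comm (x ∧ y) z 1 ⟩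
      guard z (guard (x ∧ y) 1)       ∎
      where
      open ≡-Reasoning
      x = isPath 0 w (suc j)
      y = noSameColDD (up ∷ w)
      z = compatible (last up w) (down c)

  pathsEndingUp-suc-ground : ∀ m → pathsEndingUp (suc m) 0 ≡ 0
  pathsEndingUp-suc-ground m = begin
    pathsEndingUp (suc m) 0
      ≡⟨ sumWords-∷ʳ m _ ⟩
    sumWords m (λ w → guard (admissible up 0 0 (w ∷ʳ up) ∧ not (isDown (last up (w ∷ʳ up)))) 1)
      + sum (λ c → sumWords m (λ w → guard (admissible up 0 0 (w ∷ʳ down c) ∧ not (isDown (last up (w ∷ʳ down c)))) 1))
      ≡⟨ cong₂ _+_ (trans (sumOver-cong (words (suc a) m) (λ w → cong (λ b → guard ((b ∧ noSameColDD (up ∷ w ∷ʳ up)) ∧ not (isDown (last up (w ∷ʳ up)))) 1) (isPath-∷ʳ-up-ground 0 w)))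
                          (sumOver-zero (words (suc a) m)))
                   (sum-zero (suc a) (λ c → trans (sumOver-cong (words (suc a) m) (λ w → cong (λ b → guard b 1) (lastDown w c 0)))
                                                  (sumOver-zero (words (suc a) m)))) ⟩
    0
      ∎
    where open ≡-Reasoning

  pathsEndingUp-suc : ∀ m j → pathsEndingUp (suc m) (suc j) ≡ paths up m 0 j
  pathsEndingUp-suc m j = begin
    pathsEndingUp (suc m) (suc j)
      ≡⟨ sumWords-∷ʳ m _ ⟩
    sumWords m (λ w → guard (admissible up 0 (suc j) (w ∷ʳ up) ∧ not (isDown (last up (w ∷ʳ up)))) 1)
      + sum (λ c → sumWords m (λ w → guard (admissible up 0 (suc j) (w ∷ʳ down c) ∧ not (isDown (last up (w ∷ʳ down c)))) 1))
      ≡⟨ cong₂ _+_ (sumOver-cong (words (suc a) m) lastUp-admissible)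
                   (sum-zero (suc a) (λ c → trans (sumOver-cong (words (suc a) m) (λ w → cong (λ b → guard b 1) (lastDown w c (suc j))))
                                                  (sumOver-zero (words (suc a) m)))) ⟩
    paths up m 0 j + 0
      ≡⟨ +-identityʳ _ ⟩
    paths up m 0 j
      ∎
    where
    open ≡-Reasoning
    lastUp-admissible : ∀ w → guard (admissible up 0 (suc j) (w ∷ʳ up) ∧ not (isDown (last up (w ∷ʳ up)))) 1
                             ≡ guard (admissible up 0 j w) 1
    lastUp-admissible w rewrite isPath-∷ʳ-up 0 w j | noSameColDD-∷ʳ up w up | last-∷ʳ up w up | compatible-up (last up w) =
      cong (λ b → guard b 1) (trans (∧-identityʳ _) (cong (isPath 0 w j ∧_) (∧-identityʳ _)))

  pathsEndingDown-suc : ∀ m j → pathsEndingDown (suc m) j ≡ suc a * pathsEndingUp m (suc j) + a * pathsEndingDown m (suc j)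
  pathsEndingDown-suc m j = begin
    pathsEndingDown (suc m) j
      ≡⟨ sumWords-∷ʳ m _ ⟩
    sumWords m (λ w → guard (admissible up 0 j (w ∷ʳ up) ∧ isDown (last up (w ∷ʳ up))) 1)
      + sum (λ c → sumWords m (λ w → guard (admissible up 0 j (w ∷ʳ down c) ∧ isDown (last up (w ∷ʳ down c))) 1))
      ≡⟨ cong₂ _+_ (trans (sumOver-cong (words (suc a) m) (λ w → cong (λ b → guard b 1) (lastUp w j))) (sumOver-zero (words (suc a) m)))
                   (sum-cong-≗ (λ c → sumOver-cong (words (suc a) m) (λ w → lastDown-admissible w c j))) ⟩
    0 + sum (λ c → sumWords m (λ w → guard (compatible (last up w) (down c)) (guard (A w) 1)))
      ≡⟨ sumOver-sum (words (suc a) m) (λ w c → guard (compatible (last up w) (down c)) (guard (A w) 1)) ⟨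
    sumWords m (λ w → sum (λ c → guard (compatible (last up w) (down c)) (guard (A w) 1)))
      ≡⟨ sumOver-cong (words (suc a) m) (λ w → trans (sum-compatible (last up w) (guard (A w) 1)) (by-last (A w) (last up w))) ⟩
    sumWords m (λ w → suc a * guard (A w ∧ not (isDown (last up w))) 1 + a * guard (A w ∧ isDown (last up w)) 1)
      ≡⟨ sumOver-+ (words (suc a) m) _ _ ⟩
    sumWords m (λ w → suc a * guard (A w ∧ not (isDown (last up w))) 1) + sumWords m (λ w → a * guard (A w ∧ isDown (last up w)) 1)
      ≡⟨ cong₂ _+_ (sumOver-*ˡ (words (suc a) m) (suc a) _) (sumOver-*ˡ (words (suc a) m) a _) ⟩
    suc a * pathsEndingUp m (suc j) + a * pathsEndingDown m (suc j)
      ∎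
    where
    open ≡-Reasoning
    A = admissible up 0 (suc j)
    by-last : ∀ b s → choices s * guard b 1 ≡ suc a * guard (b ∧ not (isDown s)) 1 + a * guard (b ∧ isDown s) 1
    by-last true  up       = trans (sym (+-identityʳ _)) (cong (suc a * 1 +_) (sym (*-zeroʳ a)))
    by-last true  (down _) = sym (cong (_+ a * 1) (*-zeroʳ (suc a)))
    by-last false s        = trans (*-zeroʳ (choices s)) (sym (cong₂ _+_ (*-zeroʳ (suc a)) (*-zeroʳ a)))

  paths-vanish-descent : ∀ s m h j → j + m < h → paths s m h j ≡ 0
  paths-vanish-descent s m h j j+m<h = paths-vanish s m h j (λ w ∣w∣≡m e →
    <⇒≱ j+m<h (subst (λ n → h ≤ j + n) ∣w∣≡m (isPath-descent h w j e)))

  paths-vanish-ascent : ∀ s m h j → h + m < j → paths s m h j ≡ 0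
  paths-vanish-ascent s m h j h+m<j = paths-vanish s m h j (λ w ∣w∣≡m e →
    <⇒≱ h+m<j (subst (λ n → j ≤ h + n) ∣w∣≡m (isPath-ascent h w j e)))

  paths-vanish-odd : ∀ s m h j d → h + m ≡ j + suc (2 * d) → paths s m h j ≡ 0
  paths-vanish-odd s m h j d odd = paths-vanish s m h j (λ w ∣w∣≡m e → parity w ∣w∣≡m (isPath-parity h w j e))
    where
    parity : ∀ w → length w ≡ m → ∃ (λ e → h + length w ≡ j + 2 * e) → ⊥
    parity w refl (d′ , even) = even≢odd d′ d (+-cancelˡ-≡ j _ _ (trans (sym even) odd))

  private
    sum-compatible-paths : ∀ s q h → (∀ c → paths (down c) (2 * q + h) h 0 ≡ a ^ h * P q (suc h)) →
      sum (λ c → guard (compatible s (down c)) (paths (down c) (2 * q + h) h 0)) ≡ choices s * (a ^ h * P q (suc h))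
    sum-compatible-paths s q h closed =
      trans (sum-cong-≗ (λ c → cong (guard (compatible s (down c))) (closed c))) (sum-compatible s _)

    step-down : ∀ b x p d → b * x * d + b * (x * p) ≡ b * x * (p + d)
    step-down = solve-∀

    step-up : ∀ b x p d → b * x * d + suc b * (x * p) ≡ x * (p + b * (p + d))
    step-up = solve-∀

  mutual
    paths-down-to-ground : ∀ c q h → paths (down c) (2 * q + h) h 0 ≡ a ^ h * P q (suc h)
    paths-down-to-ground c zero    zero    = refl
    paths-down-to-ground c (suc q) zero    = begin
      paths (down c) (2 * suc q + 0) 0 0    ≡⟨ cong (λ m → paths (down c) m 0 0) (length-even q) ⟩
      paths (down c) (suc (2 * q + 1)) 0 0  ≡⟨ paths-suc-ground (down c) (2 * q + 1) 0 ⟩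
      paths up (2 * q + 1) 1 0              ≡⟨ paths-up-to-ground q 0 ⟩
      a ^ 0 * Q q 1                         ∎
      where
      open ≡-Reasoning
      length-even : ∀ q → 2 * suc q + 0 ≡ suc (2 * q + 1)
      length-even = solve-∀
    paths-down-to-ground c q       (suc h) = begin
      paths (down c) (2 * q + suc h) (suc h) 0
        ≡⟨ cong (λ m → paths (down c) m (suc h) 0) (+-suc (2 * q) h) ⟩
      paths (down c) (suc (2 * q + h)) (suc h) 0
        ≡⟨ paths-suc (down c) (2 * q + h) h 0 ⟩
      paths up (2 * q + h) (suc (suc h)) 0 + sum (λ d → guard (compatible (down c) (down d)) (paths (down d) (2 * q + h) h 0))
        ≡⟨ cong₂ _+_ (paths-up-high q h) (sum-compatible-paths (down c) q h (λ d → paths-down-to-ground d q h)) ⟩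
      a * a ^ h * ΔP q (suc h) + a * (a ^ h * P q (suc h))
        ≡⟨ step-down a (a ^ h) (P q (suc h)) (ΔP q (suc h)) ⟩
      a * a ^ h * (P q (suc h) + ΔP q (suc h))
        ≡⟨ cong (a * a ^ h *_) (P-suc q (suc h)) ⟨
      a ^ suc h * P q (suc (suc h))
        ∎
      where open ≡-Reasoning

    paths-up-to-ground : ∀ q h → paths up (2 * q + suc h) (suc h) 0 ≡ a ^ h * Q q (suc h)
    paths-up-to-ground q h = begin
      paths up (2 * q + suc h) (suc h) 0
        ≡⟨ cong (λ m → paths up m (suc h) 0) (+-suc (2 * q) h) ⟩
      paths up (suc (2 * q + h)) (suc h) 0
        ≡⟨ paths-suc up (2 * q + h) h 0 ⟩
      paths up (2 * q + h) (suc (suc h)) 0 + sum (λ d → guard true (paths (down d) (2 * q + h) h 0))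
        ≡⟨ cong₂ _+_ (paths-up-high q h) (sum-compatible-paths up q h (λ d → paths-down-to-ground d q h)) ⟩
      a * a ^ h * ΔP q (suc h) + suc a * (a ^ h * P q (suc h))
        ≡⟨ step-up a (a ^ h) (P q (suc h)) (ΔP q (suc h)) ⟩
      a ^ h * (P q (suc h) + a * (P q (suc h) + ΔP q (suc h)))
        ≡⟨ cong (λ p → a ^ h * (P q (suc h) + a * p)) (P-suc q (suc h)) ⟨
      a ^ h * Q q (suc h)
        ∎
      where open ≡-Reasoning

    paths-up-high : ∀ q h → paths up (2 * q + h) (suc (suc h)) 0 ≡ a ^ suc h * ΔP q (suc h)
    paths-up-high zero    h = trans (paths-vanish-descent up h (suc (suc h)) 0 (s≤s (n≤1+n h))) (sym (*-zeroʳ (a ^ suc h)))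
    paths-up-high (suc q) h = trans (cong (λ m → paths up m (suc (suc h)) 0) (length-shift q h)) (paths-up-to-ground q (suc h))
      where
      length-shift : ∀ q h → 2 * suc q + h ≡ 2 * q + suc (suc h)
      length-shift = solve-∀

  mutual
    pathsEndingUp-from-ground : ∀ s j → pathsEndingUp (2 * s + j) j ≡ P s j
    pathsEndingUp-from-ground zero    zero    = refl
    pathsEndingUp-from-ground (suc s) zero    =
      trans (cong (λ m → pathsEndingUp m 0) (length-even s)) (pathsEndingUp-suc-ground (2 * s + 1))
      where
      length-even : ∀ s → 2 * suc s + 0 ≡ suc (2 * s + 1)
      length-even = solve-∀
    pathsEndingUp-from-ground s       (suc j) =
      trans (cong (λ m → pathsEndingUp m (suc j)) (+-suc (2 * s) j))
            (trans (pathsEndingUp-suc (2 * s + j) j) (paths-from-ground s j))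

    pathsEndingDown-from-ground : ∀ s j → pathsEndingDown (2 * s + j) j ≡ ΔP s j
    pathsEndingDown-from-ground zero    zero    = refl
    pathsEndingDown-from-ground zero    (suc j) = begin
      pathsEndingDown (suc j) (suc j)
        ≡⟨ pathsEndingDown-suc j (suc j) ⟩
      suc a * pathsEndingUp j (suc (suc j)) + a * pathsEndingDown j (suc (suc j))
        ≡⟨ cong₂ (λ u d → suc a * u + a * d) (m+n≡0⇒m≡0 _ too-high) (m+n≡0⇒n≡0 _ too-high) ⟩
      suc a * 0 + a * 0
        ≡⟨ cong₂ _+_ (*-zeroʳ (suc a)) (*-zeroʳ a) ⟩
      0
        ∎
      where
      open ≡-Reasoning
      too-high : pathsEndingUp j (suc (suc j)) + pathsEndingDown j (suc (suc j)) ≡ 0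
      too-high = trans (sym (paths-by-last j (suc (suc j)))) (paths-vanish-ascent up j 0 (suc (suc j)) (s≤s (n≤1+n j)))
    pathsEndingDown-from-ground (suc s) j = begin
      pathsEndingDown (2 * suc s + j) j
        ≡⟨ cong (λ m → pathsEndingDown m j) (length-shift s j) ⟩
      pathsEndingDown (suc (2 * s + suc j)) j
        ≡⟨ pathsEndingDown-suc (2 * s + suc j) j ⟩
      suc a * pathsEndingUp (2 * s + suc j) (suc j) + a * pathsEndingDown (2 * s + suc j) (suc j)
        ≡⟨ cong₂ (λ u d → suc a * u + a * d) (pathsEndingUp-from-ground s (suc j)) (pathsEndingDown-from-ground s (suc j)) ⟩
      suc a * P s (suc j) + a * ΔP s (suc j)
        ≡⟨ regroup a (P s (suc j)) (ΔP s (suc j)) ⟩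
      P s (suc j) + a * (P s (suc j) + ΔP s (suc j))
        ≡⟨ cong (λ p → P s (suc j) + a * p) (P-suc s (suc j)) ⟨
      Q s (suc j)
        ∎
      where
      open ≡-Reasoning
      length-shift : ∀ s j → 2 * suc s + j ≡ suc (2 * s + suc j)
      length-shift = solve-∀
      regroup : ∀ b p d → suc b * p + b * d ≡ p + b * (p + d)
      regroup = solve-∀

    paths-from-ground : ∀ s j → paths up (2 * s + j) 0 j ≡ P s (suc j)
    paths-from-ground s j = begin
      paths up (2 * s + j) 0 j
        ≡⟨ paths-by-last (2 * s + j) j ⟩
      pathsEndingUp (2 * s + j) j + pathsEndingDown (2 * s + j) j
        ≡⟨ cong₂ _+_ (pathsEndingUp-from-ground s j) (pathsEndingDown-from-ground s j) ⟩
      P s j + ΔP s j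
        ≡⟨ P-suc s j ⟨
      P s (suc j)
        ∎
      where open ≡-Reasoning

  private
    junction : ∀ s h ℓ (F : ℕ → ℕ) → guard ⌊ suc h ≟ suc ℓ ⌋ (F (suc h)) ≡ paths s 0 h ℓ * F (suc ℓ)
    junction s h ℓ F rewrite ≟-suc h ℓ | paths-zero s h ℓ with h ≟ ℓ
    ... | yes refl = sym (+-identityʳ _)
    ... | no _     = refl

    merge : ∀ m (A : ℕ → ℕ) (g : Fin (suc a) → Bool) (B : Fin (suc a) → ℕ → ℕ) (E : ℕ → ℕ) →
      ∑[ t < m ] (A t * E t) + sum (λ c → guard (g c) (∑[ t < m ] (B c t * E t)))
        ≡ ∑[ t < m ] ((A t + sum (λ c → guard (g c) (B c t))) * E t)
    merge m A g B E = begin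
      ∑[ t < m ] (A t * E t) + sum (λ c → guard (g c) (∑[ t < m ] (B c t * E t)))
        ≡⟨ cong (∑[ t < m ] (A t * E t) +_) (sum-cong-≗ (λ c → ∑<-guard m (g c) (λ t → B c t * E t))) ⟨
      ∑[ t < m ] (A t * E t) + sum (λ c → ∑[ t < m ] guard (g c) (B c t * E t))
        ≡⟨ cong (∑[ t < m ] (A t * E t) +_) (∑<-sum-comm m (λ t c → guard (g c) (B c t * E t))) ⟨
      ∑[ t < m ] (A t * E t) + ∑[ t < m ] sum (λ c → guard (g c) (B c t * E t))
        ≡⟨ ∑<-+ m (λ t → A t * E t) (λ t → sum (λ c → guard (g c) (B c t * E t))) ⟨
      ∑[ t < m ] (A t * E t + sum (λ c → guard (g c) (B c t * E t)))
        ≡⟨ ∑<-cong m (λ t _ → pointwise t) ⟩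
      ∑[ t < m ] ((A t + sum (λ c → guard (g c) (B c t))) * E t)
        ∎
      where
      open ≡-Reasoning
      pointwise : ∀ t → A t * E t + sum (λ c → guard (g c) (B c t * E t)) ≡ (A t + sum (λ c → guard (g c) (B c t))) * E t
      pointwise t = begin
        A t * E t + sum (λ c → guard (g c) (B c t * E t))    ≡⟨ cong (A t * E t +_) (sum-cong-≗ (λ c → guard-*ʳ (g c) (B c t) (E t))) ⟩
        A t * E t + sum (λ c → guard (g c) (B c t) * E t)    ≡⟨ cong (A t * E t +_) (*-distribʳ-sum (E t) (λ c → guard (g c) (B c t))) ⟨
        A t * E t + sum (λ c → guard (g c) (B c t)) * E t    ≡⟨ *-distribʳ-+ (E t) (A t) _ ⟨
        (A t + sum (λ c → guard (g c) (B c t))) * E t        ∎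

  -- Split at each u-step at level ℓ+1; that u-step breaks every run of d-steps, so the colour
  -- condition holds on the two parts separately.
  levelUps-decomposition : ∀ ℓ s m h →
    levelUps (suc ℓ) s m h ≡ ∑[ t < m ] (paths s t h ℓ * paths up (m ∸ suc t) (suc ℓ) 0)
  levelUps-decomposition ℓ s zero    h       = levelUps-zero (suc ℓ) s h
  levelUps-decomposition ℓ s (suc m) zero    = begin
    levelUps (suc ℓ) s (suc m) 0
      ≡⟨ levelUps-suc-ground (suc ℓ) s m ⟩
    guard ⌊ 1 ≟ suc ℓ ⌋ (paths up m 1 0) + levelUps (suc ℓ) up m 1
      ≡⟨ cong₂ _+_ (junction s 0 ℓ (λ k → paths up m k 0)) (levelUps-decomposition ℓ up m 1) ⟩
    paths s 0 0 ℓ * E 0 + ∑[ t < m ] (paths up t 1 ℓ * E (suc t))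
      ≡⟨ cong (paths s 0 0 ℓ * E 0 +_) (∑<-cong m (λ t _ → cong (_* E (suc t)) (paths-suc-ground s t ℓ))) ⟨
    ∑[ t < suc m ] (paths s t 0 ℓ * E t)
      ∎
    where
    open ≡-Reasoning
    E : ℕ → ℕ
    E t = paths up (suc m ∸ suc t) (suc ℓ) 0
  levelUps-decomposition ℓ s (suc m) (suc h) = begin
    levelUps (suc ℓ) s (suc m) (suc h)
      ≡⟨ levelUps-suc (suc ℓ) s m h ⟩
    guard ⌊ suc (suc h) ≟ suc ℓ ⌋ (paths up m (suc (suc h)) 0) + levelUps (suc ℓ) up m (suc (suc h))
      + sum (λ c → guard (g c) (levelUps (suc ℓ) (down c) m h))
      ≡⟨ cong₂ _+_ (cong₂ _+_ (junction s (suc h) ℓ (λ k → paths up m k 0)) (levelUps-decomposition ℓ up m (suc (suc h))))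
                   (sum-cong-≗ (λ c → cong (guard (g c)) (levelUps-decomposition ℓ (down c) m h))) ⟩
    paths s 0 (suc h) ℓ * E 0 + ∑[ t < m ] (paths up t (suc (suc h)) ℓ * E (suc t))
      + sum (λ c → guard (g c) (∑[ t < m ] (paths (down c) t h ℓ * E (suc t))))
      ≡⟨ +-assoc (paths s 0 (suc h) ℓ * E 0) _ _ ⟩
    paths s 0 (suc h) ℓ * E 0 + (∑[ t < m ] (paths up t (suc (suc h)) ℓ * E (suc t))
      + sum (λ c → guard (g c) (∑[ t < m ] (paths (down c) t h ℓ * E (suc t)))))
      ≡⟨ cong (paths s 0 (suc h) ℓ * E 0 +_) (merge m (λ t → paths up t (suc (suc h)) ℓ) g (λ c t → paths (down c) t h ℓ) (E ∘ suc)) ⟩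
    paths s 0 (suc h) ℓ * E 0
      + ∑[ t < m ] ((paths up t (suc (suc h)) ℓ + sum (λ c → guard (g c) (paths (down c) t h ℓ))) * E (suc t))
      ≡⟨ cong (paths s 0 (suc h) ℓ * E 0 +_) (∑<-cong m (λ t _ → cong (_* E (suc t)) (paths-suc s t h ℓ))) ⟨
    ∑[ t < suc m ] (paths s t (suc h) ℓ * E t)
      ∎
    where
    open ≡-Reasoning
    g : Fin (suc a) → Bool
    g c = compatible s (down c)
    E : ℕ → ℕ
    E t = paths up (suc m ∸ suc t) (suc ℓ) 0

  U≡levelUps : ∀ n ℓ → U (suc a) n ℓ ≡ levelUps (suc ℓ) up (2 * suc n) 0
  U≡levelUps n ℓ = sumOver-cong (words (suc a) (2 * suc n)) (λ w →
    cong₂ (λ d c → guard (d ∧ c) (upsAtFrom (suc ℓ) 0 w)) (dyckFrom≡isPath 0 w) (sym (noSameColDD-up∷ w)))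

  private
    split-term : ℕ → ℕ → ℕ → ℕ
    split-term ℓ M t = paths up t 0 ℓ * paths up (M ∸ suc t) (suc ℓ) 0

    -- Only split points t = ℓ + 2s contribute: before ℓ the prefix cannot reach height ℓ, after
    -- M - ℓ - 1 the suffix cannot return to 0, and an odd excess t - ℓ has the wrong parity.
    split-sum : ∀ ℓ m →
      ∑[ t < 2 * suc (ℓ + m) ] split-term ℓ (2 * suc (ℓ + m)) t ≡ a ^ ℓ * ∑[ s < suc m ] (P s (suc ℓ) * Q (m ∸ s) (suc ℓ))
    split-sum ℓ m = begin
      ∑[ t < 2 * suc (ℓ + m) ] split-term ℓ (2 * suc (ℓ + m)) t
        ≡⟨ cong (λ n → ∑< n (split-term ℓ n)) (length-split ℓ m) ⟩
      ∑< (ℓ + D + ℓ) F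
        ≡⟨ ∑<-split (ℓ + D) ℓ F ⟩
      ∑< (ℓ + D) F + ∑[ u < ℓ ] F (ℓ + D + u)
        ≡⟨ cong₂ _+_ (∑<-split ℓ D F) (∑<-zero ℓ (λ u → F (ℓ + D + u)) suffix-vanishes) ⟩
      ∑< ℓ F + ∑[ v < D ] F (ℓ + v) + 0
        ≡⟨ cong (λ x → x + ∑[ v < D ] F (ℓ + v) + 0) (∑<-zero ℓ F prefix-vanishes) ⟩
      ∑[ v < D ] F (ℓ + v) + 0
        ≡⟨ +-identityʳ _ ⟩
      ∑[ v < D ] F (ℓ + v)
        ≡⟨ ∑<-pairs (suc m) (λ v → F (ℓ + v)) ⟩
      ∑[ s < suc m ] (F (ℓ + 2 * s) + F (ℓ + suc (2 * s)))
        ≡⟨ ∑<-cong (suc m) (λ s s<m → cong₂ _+_ (even-term s (≤-pred s<m)) (odd-vanishes s)) ⟩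
      ∑[ s < suc m ] (P s (suc ℓ) * (a ^ ℓ * Q (m ∸ s) (suc ℓ)) + 0)
        ≡⟨ ∑<-cong (suc m) (λ s _ → trans (+-identityʳ _) (x*[y*z]≡y*[x*z] (P s (suc ℓ)) (a ^ ℓ) (Q (m ∸ s) (suc ℓ)))) ⟩
      ∑[ s < suc m ] (a ^ ℓ * (P s (suc ℓ) * Q (m ∸ s) (suc ℓ)))
        ≡⟨ ∑<-*ˡ (suc m) (a ^ ℓ) (λ s → P s (suc ℓ) * Q (m ∸ s) (suc ℓ)) ⟩
      a ^ ℓ * ∑[ s < suc m ] (P s (suc ℓ) * Q (m ∸ s) (suc ℓ))
        ∎
      where
      open ≡-Reasoning
      D = 2 * suc m
      M = ℓ + D + ℓ
      F = split-term ℓ M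
      length-split : ∀ ℓ m → 2 * suc (ℓ + m) ≡ ℓ + 2 * suc m + ℓ
      length-split = solve-∀
      x*[y*z]≡y*[x*z] : ∀ x y z → x * (y * z) ≡ y * (x * z)
      x*[y*z]≡y*[x*z] = solve-∀

      prefix-vanishes : ∀ t → t < ℓ → F t ≡ 0
      prefix-vanishes t t<ℓ = cong (_* paths up (M ∸ suc t) (suc ℓ) 0) (paths-vanish-ascent up t 0 ℓ t<ℓ)

      suffix-vanishes : ∀ u → u < ℓ → F (ℓ + D + u) ≡ 0
      suffix-vanishes u _ = trans (cong (paths up (ℓ + D + u) 0 ℓ *_) (paths-vanish-descent up _ (suc ℓ) 0 (s≤s short)))
                                  (*-zeroʳ (paths up (ℓ + D + u) 0 ℓ))
        where
        short : M ∸ suc (ℓ + D + u) ≤ ℓ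
        short = ≤-trans (∸-monoʳ-≤ M (≤-trans (m≤m+n (ℓ + D) u) (n≤1+n _))) (≤-reflexive (m+n∸m≡n (ℓ + D) ℓ))

      odd-vanishes : ∀ s → F (ℓ + suc (2 * s)) ≡ 0
      odd-vanishes s = cong (_* paths up (M ∸ suc (ℓ + suc (2 * s))) (suc ℓ) 0) (paths-vanish-odd up (ℓ + suc (2 * s)) 0 ℓ s refl)

      even-term : ∀ s → s ≤ m → F (ℓ + 2 * s) ≡ P s (suc ℓ) * (a ^ ℓ * Q (m ∸ s) (suc ℓ))
      even-term s s≤m with m≤n⇒∃[o]m+o≡n s≤m
      ... | q , refl = cong₂ _*_
        (trans (cong (λ n → paths up n 0 ℓ) (+-comm ℓ (2 * s))) (paths-from-ground s ℓ))
        (begin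
          paths up (M ∸ suc (ℓ + 2 * s)) (suc ℓ) 0
            ≡⟨ cong (λ n → paths up (n ∸ suc (ℓ + 2 * s)) (suc ℓ) 0) (suffix-length ℓ s q) ⟩
          paths up (suc (ℓ + 2 * s) + (2 * q + suc ℓ) ∸ suc (ℓ + 2 * s)) (suc ℓ) 0
            ≡⟨ cong (λ n → paths up n (suc ℓ) 0) (m+n∸m≡n (suc (ℓ + 2 * s)) (2 * q + suc ℓ)) ⟩
          paths up (2 * q + suc ℓ) (suc ℓ) 0
            ≡⟨ paths-up-to-ground q ℓ ⟩
          a ^ ℓ * Q q (suc ℓ)
            ≡⟨ cong (λ n → a ^ ℓ * Q n (suc ℓ)) (m+n∸m≡n s q) ⟨
          a ^ ℓ * Q (s + q ∸ s) (suc ℓ)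
            ∎)
        where
        suffix-length : ∀ ℓ s q → ℓ + 2 * suc (s + q) + ℓ ≡ suc (ℓ + 2 * s) + (2 * q + suc ℓ)
        suffix-length = solve-∀

  U-closed-form : ∀ ℓ m → U (suc a) (ℓ + m) ℓ ≡ a ^ ℓ * Q m (2 * ℓ + 2)
  U-closed-form ℓ m = begin
    U (suc a) (ℓ + m) ℓ
      ≡⟨ U≡levelUps (ℓ + m) ℓ ⟩
    levelUps (suc ℓ) up (2 * suc (ℓ + m)) 0
      ≡⟨ levelUps-decomposition ℓ up (2 * suc (ℓ + m)) 0 ⟩
    ∑[ t < 2 * suc (ℓ + m) ] split-term ℓ (2 * suc (ℓ + m)) t
      ≡⟨ split-sum ℓ m ⟩
    a ^ ℓ * ∑[ s < suc m ] (P s (suc ℓ) * Q (m ∸ s) (suc ℓ))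
      ≡⟨ cong (a ^ ℓ *_) (Q-convolution (suc ℓ) m (suc ℓ)) ⟩
    a ^ ℓ * Q m (suc ℓ + suc ℓ)
      ≡⟨ cong (λ k → a ^ ℓ * Q m k) (double-suc ℓ) ⟩
    a ^ ℓ * Q m (2 * ℓ + 2)
      ∎
    where
    open ≡-Reasoning
    double-suc : ∀ ℓ → suc ℓ + suc ℓ ≡ 2 * ℓ + 2
    double-suc = solve-∀

module PowerSeries where

  open import Defs using (PS; sumℤ; _⊕_; _⊛_; const; xmul; pow; IsSr; riordan)
  open import Data.Nat as ℕ using (ℕ; zero; suc; _∸_; _^_)
  import Data.Nat.Properties as ℕ
  open import Data.Integer using (+_; _+_; _*_)
  open import Data.Integer.Properties
  open import Data.Integer.Tactic.RingSolver using (solve-∀)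
  open import Data.List using (applyUpTo)
  open import Data.List.Properties using (map-upTo)
  open import Function using (_∘_)
  open import Relation.Binary.PropositionalEquality

  infix 4 _≈_
  _≈_ : PS → PS → Set
  f ≈ g = ∀ n → f n ≡ g n

  tail : PS → PS
  tail f n = f (suc n)

  conv : PS → PS → PS
  conv f g zero    = f 0 * g 0
  conv f g (suc n) = f 0 * g (suc n) + conv (tail f) g n

  ⊛≡conv : ∀ f g → f ⊛ g ≈ conv f g
  ⊛≡conv f g n = trans (cong sumℤ (map-upTo (λ i → f i * g (n ∸ i)) (suc n))) (applyUpTo≡conv n f)
    where
    applyUpTo≡conv : ∀ n f → sumℤ (applyUpTo (λ i → f i * g (n ∸ i)) (suc n)) ≡ conv f g n
    applyUpTo≡conv zero    f = +-identityʳ _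
    applyUpTo≡conv (suc n) f = cong (λ z → f 0 * g (suc n) + z) (applyUpTo≡conv n (tail f))

  conv-cong : ∀ n {f f′ g g′} → f ≈ f′ → g ≈ g′ → conv f g n ≡ conv f′ g′ n
  conv-cong zero    f≈f′ g≈g′ = cong₂ _*_ (f≈f′ 0) (g≈g′ 0)
  conv-cong (suc n) f≈f′ g≈g′ = cong₂ _+_ (cong₂ _*_ (f≈f′ 0) (g≈g′ (suc n))) (conv-cong n (f≈f′ ∘ suc) g≈g′)

  conv-congʳ : ∀ n f {g g′} → g ≈ g′ → conv f g n ≡ conv f g′ n
  conv-congʳ n f = conv-cong n (λ _ → refl)

  private
    conv-suc-last : ∀ n f g → conv f g (suc n) ≡ f (suc n) * g 0 + conv f (tail g) n
    conv-suc-last zero    f g = +-comm (f 0 * g 1) (f 1 * g 0)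
    conv-suc-last (suc n) f g = trans (cong (λ z → f 0 * g (suc (suc n)) + z) (conv-suc-last n (tail f) g))
                                      (swap (f 0 * g (suc (suc n))) (f (suc (suc n)) * g 0) (conv (tail f) (tail g) n))
      where
      swap : ∀ x y z → x + (y + z) ≡ y + (x + z)
      swap = solve-∀

  conv-comm : ∀ n f g → conv f g n ≡ conv g f n
  conv-comm zero    f g = *-comm (f 0) (g 0)
  conv-comm (suc n) f g = trans (cong₂ _+_ (*-comm (f 0) (g (suc n))) (conv-comm n (tail f) g)) (sym (conv-suc-last n g f))

  conv-*ˡ : ∀ n c f g → conv (λ i → c * f i) g n ≡ c * conv f g n
  conv-*ˡ zero    c f g = *-assoc c (f 0) (g 0)
  conv-*ˡ (suc n) c f g = trans (cong₂ _+_ (*-assoc c (f 0) (g (suc n))) (conv-*ˡ n c (tail f) g)) (sym (*-distribˡ-+ c _ _))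

  conv-*ʳ : ∀ n c f g → conv f (λ i → c * g i) n ≡ c * conv f g n
  conv-*ʳ n c f g = trans (conv-comm n f _) (trans (conv-*ˡ n c g f) (cong (c *_) (conv-comm n g f)))

  conv-constˡ : ∀ n c g → conv (const c) g n ≡ c * g n
  conv-constˡ zero    c g = refl
  conv-constˡ (suc n) c g = trans (cong (λ z → c * g (suc n) + z) (conv-zeroˡ n g)) (+-identityʳ _)
    where
    conv-zeroˡ : ∀ n g → conv (λ _ → + 0) g n ≡ + 0
    conv-zeroˡ zero    g = refl
    conv-zeroˡ (suc n) g = cong₂ _+_ (*-zeroˡ (g (suc n))) (conv-zeroˡ n g)

  conv-xmulˡ : ∀ n f g → conv (xmul f) g (suc n) ≡ conv f g n
  conv-xmulˡ n f g = +-identityˡ _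

  conv-xmulʳ : ∀ n f g → conv f (xmul g) n ≡ xmul (conv f g) n
  conv-xmulʳ zero    f g = *-zeroʳ (f 0)
  conv-xmulʳ (suc n) f g = trans (conv-comm (suc n) f (xmul g)) (trans (conv-xmulˡ n g f) (conv-comm n g f))

  conv-distribʳ-+ : ∀ n f g h → conv (λ i → f i + g i) h n ≡ conv f h n + conv g h n
  conv-distribʳ-+ zero    f g h = *-distribʳ-+ (h 0) (f 0) (g 0)
  conv-distribʳ-+ (suc n) f g h =
    trans (cong₂ _+_ (*-distribʳ-+ (h (suc n)) (f 0) (g 0)) (conv-distribʳ-+ n (tail f) (tail g) h))
          (interchange (f 0 * h (suc n)) (g 0 * h (suc n)) (conv (tail f) h n) (conv (tail g) h n))
    where
    interchange : ∀ a b c d → (a + b) + (c + d) ≡ (a + c) + (b + d)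
    interchange = solve-∀

  conv-distribˡ-+ : ∀ n f g h → conv f (λ i → g i + h i) n ≡ conv f g n + conv f h n
  conv-distribˡ-+ n f g h =
    trans (conv-comm n f _) (trans (conv-distribʳ-+ n g h f) (cong₂ _+_ (conv-comm n g f) (conv-comm n h f)))

  conv-assoc : ∀ n f g h → conv (conv f g) h n ≡ conv f (conv g h) n
  conv-assoc zero    f g h = *-assoc (f 0) (g 0) (h 0)
  conv-assoc (suc n) f g h = begin
    conv f g 0 * h (suc n) + conv (tail (conv f g)) h n
      ≡⟨ cong (λ z → conv f g 0 * h (suc n) + z) (conv-distribʳ-+ n (λ i → f 0 * g (suc i)) (conv (tail f) g) h) ⟩
    conv f g 0 * h (suc n) + (conv (λ i → f 0 * g (suc i)) h n + conv (conv (tail f) g) h n)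
      ≡⟨ cong (λ z → conv f g 0 * h (suc n) + z) (cong₂ _+_ (conv-*ˡ n (f 0) (tail g) h) (conv-assoc n (tail f) g h)) ⟩
    f 0 * g 0 * h (suc n) + (f 0 * conv (tail g) h n + conv (tail f) (conv g h) n)
      ≡⟨ regroup (f 0) (g 0) (h (suc n)) (conv (tail g) h n) (conv (tail f) (conv g h) n) ⟩
    f 0 * (g 0 * h (suc n) + conv (tail g) h n) + conv (tail f) (conv g h) n
      ∎
    where
    open ≡-Reasoning
    regroup : ∀ a b c x y → a * b * c + (a * x + y) ≡ a * (b * c + x) + y
    regroup = solve-∀

  module PowersOfS (a : ℕ) (S : PS) (S-eq : IsSr (suc a) S) where

    open Coefficients a

    S-zero : S 0 ≡ + 1
    S-zero = trans (S-eq 0) (cong (λ z → + 1 + (+ 0 + z)) (trans (⊛≡conv (const (+ a)) (xmul (S ⊛ S)) 0) (*-zeroʳ (+ a))))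

    pow-zero : ∀ k → pow S k 0 ≡ + 1
    pow-zero zero    = refl
    pow-zero (suc k) = trans (⊛≡conv S (pow S k) 0) (cong₂ _*_ S-zero (pow-zero k))

    pow-conv : ∀ i j → pow S (i ℕ.+ j) ≈ conv (pow S i) (pow S j)
    pow-conv zero    j n = sym (trans (conv-constˡ n (+ 1) (pow S j)) (*-identityˡ _))
    pow-conv (suc i) j n = begin
      (S ⊛ pow S (i ℕ.+ j)) n                ≡⟨ ⊛≡conv S _ n ⟩
      conv S (pow S (i ℕ.+ j)) n             ≡⟨ conv-cong n (λ _ → refl) (pow-conv i j) ⟩
      conv S (conv (pow S i) (pow S j)) n    ≡⟨ conv-assoc n S (pow S i) (pow S j) ⟨
      conv (conv S (pow S i)) (pow S j) n    ≡⟨ conv-cong n (λ k → sym (⊛≡conv S (pow S i) k)) (λ _ → refl) ⟩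
      conv (pow S (suc i)) (pow S j) n       ∎
      where open ≡-Reasoning

    pow-suc-suc : ∀ s k → pow S (suc k) (suc s) ≡ pow S k (suc s) + (pow S (suc k) s + + a * pow S (suc (suc k)) s)
    pow-suc-suc s k = begin
      pow S (suc k) (suc s)
        ≡⟨ ⊛≡conv S X (suc s) ⟩
      conv S X (suc s)
        ≡⟨ conv-cong (suc s) S-eq (λ _ → refl) ⟩
      conv (λ i → const (+ 1) i + (xmul S i + (const (+ a) ⊛ xmul (S ⊛ S)) i)) X (suc s)
        ≡⟨ conv-distribʳ-+ (suc s) (const (+ 1)) (λ i → xmul S i + (const (+ a) ⊛ xmul (S ⊛ S)) i) X ⟩
      conv (const (+ 1)) X (suc s) + conv (λ i → xmul S i + (const (+ a) ⊛ xmul (S ⊛ S)) i) X (suc s)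
        ≡⟨ cong₂ _+_ (trans (conv-constˡ (suc s) (+ 1) X) (*-identityˡ _)) (conv-distribʳ-+ (suc s) (xmul S) (const (+ a) ⊛ xmul (S ⊛ S)) X) ⟩
      X (suc s) + (conv (xmul S) X (suc s) + conv (const (+ a) ⊛ xmul (S ⊛ S)) X (suc s))
        ≡⟨ cong (λ z → X (suc s) + z) (cong₂ _+_ (trans (conv-xmulˡ s S X) (sym (⊛≡conv S X s))) quadratic-term) ⟩
      X (suc s) + (pow S (suc k) s + + a * pow S (suc (suc k)) s)
        ∎
      where
      open ≡-Reasoning
      X = pow S k
      quadratic-term : conv (const (+ a) ⊛ xmul (S ⊛ S)) X (suc s) ≡ + a * pow S (suc (suc k)) s
      quadratic-term = begin
        conv (const (+ a) ⊛ xmul (S ⊛ S)) X (suc s)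
          ≡⟨ conv-cong (suc s) (λ i → trans (⊛≡conv (const (+ a)) (xmul (S ⊛ S)) i) (conv-constˡ i (+ a) (xmul (S ⊛ S)))) (λ _ → refl) ⟩
        conv (λ i → + a * xmul (S ⊛ S) i) X (suc s)
          ≡⟨ conv-*ˡ (suc s) (+ a) (xmul (S ⊛ S)) X ⟩
        + a * conv (xmul (S ⊛ S)) X (suc s)
          ≡⟨ cong (+ a *_) (conv-xmulˡ s (S ⊛ S) X) ⟩
        + a * conv (S ⊛ S) X s
          ≡⟨ cong (+ a *_) (conv-cong s (⊛≡conv S S) (λ _ → refl)) ⟩
        + a * conv (conv S S) X s
          ≡⟨ cong (+ a *_) (conv-assoc s S S X) ⟩
        + a * conv S (conv S X) s
          ≡⟨ cong (+ a *_) (trans (conv-cong s (λ _ → refl) (λ i → sym (⊛≡conv S X i))) (sym (⊛≡conv S (S ⊛ X) s))) ⟩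
        + a * pow S (suc (suc k)) s
          ∎

    pow≡P : ∀ s k → pow S k s ≡ + P s k
    pow≡P zero    k       = pow-zero k
    pow≡P (suc s) zero    = refl
    pow≡P (suc s) (suc k) = begin
      pow S (suc k) (suc s)
        ≡⟨ pow-suc-suc s k ⟩
      pow S k (suc s) + (pow S (suc k) s + + a * pow S (suc (suc k)) s)
        ≡⟨ cong₂ _+_ (pow≡P (suc s) k) (cong₂ _+_ (pow≡P s (suc k)) (cong (+ a *_) (pow≡P s (suc (suc k))))) ⟩
      + P (suc s) k + (+ P s (suc k) + + a * + P s (suc (suc k)))
        ≡⟨ cong (λ z → + P (suc s) k + (+ P s (suc k) + z)) (pos-* a _) ⟨
      + P (suc s) k + (+ P s (suc k) + + (a ℕ.* P s (suc (suc k))))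
        ≡⟨ cong (λ z → + P (suc s) k + z) (pos-+ (P s (suc k)) _) ⟨
      + P (suc s) k + + (P s (suc k) ℕ.+ a ℕ.* P s (suc (suc k)))
        ≡⟨ pos-+ (P (suc s) k) _ ⟨
      + (P (suc s) k ℕ.+ (P s (suc k) ℕ.+ a ℕ.* P s (suc (suc k))))
        ≡⟨ cong +_ (ℕ.+-assoc (P (suc s) k) _ _) ⟨
      + P (suc s) (suc k)
        ∎
      where open ≡-Reasoning

    h : PS
    h = xmul (const (+ a) ⊛ pow S 2)

    d : PS
    d = pow S 2 ⊛ (const (+ 1) ⊕ (const (+ a) ⊛ S))

    shift : ℕ → PS → PS
    shift zero    F = F
    shift (suc l) F = xmul (shift l F)

    shift-cong : ∀ l {F F′} → F ≈ F′ → shift l F ≈ shift l F′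
    shift-cong zero    F≈F′ n       = F≈F′ n
    shift-cong (suc l) F≈F′ zero    = refl
    shift-cong (suc l) F≈F′ (suc n) = shift-cong l F≈F′ n

    conv-shift : ∀ l n f F → conv f (shift l F) n ≡ shift l (conv f F) n
    conv-shift zero    n       f F = refl
    conv-shift (suc l) zero    f F = conv-xmulʳ zero f (shift l F)
    conv-shift (suc l) (suc n) f F = trans (conv-xmulʳ (suc n) f (shift l F)) (conv-shift l n f F)

    shift-+ : ∀ l m F → shift l F (l ℕ.+ m) ≡ F m
    shift-+ zero    m F = refl
    shift-+ (suc l) m F = shift-+ l m F

    scaledPow : ℕ → PS
    scaledPow l i = + (a ^ l) * pow S (l ℕ.+ l) i

    pow-h : ∀ l → pow h l ≈ shift l (scaledPow l)
    pow-h zero    n       = sym (*-identityˡ _)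
    pow-h (suc l) zero    = trans (⊛≡conv h (pow h l) 0) (conv-congʳ 0 h (pow-h l))
    pow-h (suc l) (suc n) = begin
      (h ⊛ pow h l) (suc n)                            ≡⟨ ⊛≡conv h (pow h l) (suc n) ⟩
      conv h (pow h l) (suc n)                         ≡⟨ conv-congʳ (suc n) h (pow-h l) ⟩
      conv h (shift l (scaledPow l)) (suc n)           ≡⟨ conv-xmulˡ n (const (+ a) ⊛ pow S 2) (shift l (scaledPow l)) ⟩
      conv (const (+ a) ⊛ pow S 2) (shift l (scaledPow l)) n  ≡⟨ conv-shift l n (const (+ a) ⊛ pow S 2) (scaledPow l) ⟩
      shift l (conv (const (+ a) ⊛ pow S 2) (scaledPow l)) n  ≡⟨ shift-cong l step n ⟩
      shift l (scaledPow (suc l)) n                    ∎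
      where
      open ≡-Reasoning
      step : conv (const (+ a) ⊛ pow S 2) (scaledPow l) ≈ scaledPow (suc l)
      step i = begin
        conv (const (+ a) ⊛ pow S 2) (scaledPow l) i
          ≡⟨ conv-cong i (λ k → trans (⊛≡conv (const (+ a)) (pow S 2) k) (conv-constˡ k (+ a) (pow S 2))) (λ _ → refl) ⟩
        conv (λ k → + a * pow S 2 k) (scaledPow l) i
          ≡⟨ conv-*ˡ i (+ a) (pow S 2) (scaledPow l) ⟩
        + a * conv (pow S 2) (scaledPow l) i
          ≡⟨ cong (+ a *_) (conv-*ʳ i (+ (a ^ l)) (pow S 2) (pow S (l ℕ.+ l))) ⟩
        + a * (+ (a ^ l) * conv (pow S 2) (pow S (l ℕ.+ l)) i)
          ≡⟨ cong (λ z → + a * (+ (a ^ l) * z)) (pow-conv 2 (l ℕ.+ l) i) ⟨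
        + a * (+ (a ^ l) * pow S (2 ℕ.+ (l ℕ.+ l)) i)
          ≡⟨ *-assoc (+ a) (+ (a ^ l)) _ ⟨
        + a * + (a ^ l) * pow S (2 ℕ.+ (l ℕ.+ l)) i
          ≡⟨ cong₂ _*_ (pos-* a (a ^ l)) (cong (λ k → pow S k i) (cong suc (ℕ.+-suc l l))) ⟨
        scaledPow (suc l) i
          ∎

    d-expand : d ≈ (λ i → pow S 2 i + + a * pow S 3 i)
    d-expand n = begin
      d n
        ≡⟨ ⊛≡conv (pow S 2) _ n ⟩
      conv (pow S 2) (λ i → const (+ 1) i + (const (+ a) ⊛ S) i) n
        ≡⟨ conv-distribˡ-+ n (pow S 2) (const (+ 1)) (const (+ a) ⊛ S) ⟩
      conv (pow S 2) (const (+ 1)) n + conv (pow S 2) (const (+ a) ⊛ S) n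
        ≡⟨ cong₂ _+_ (trans (conv-comm n (pow S 2) (const (+ 1))) (trans (conv-constˡ n (+ 1) (pow S 2)) (*-identityˡ _)))
                     (conv-cong n (λ _ → refl) (λ i → trans (⊛≡conv (const (+ a)) S i) (conv-constˡ i (+ a) S))) ⟩
      pow S 2 n + conv (pow S 2) (λ i → + a * S i) n
        ≡⟨ cong (λ z → pow S 2 n + z) (trans (conv-*ʳ n (+ a) (pow S 2) S)
                                           (cong (+ a *_) (trans (conv-comm n (pow S 2) S) (sym (⊛≡conv S (pow S 2) n))))) ⟩
      pow S 2 n + + a * pow S 3 n
        ∎
      where open ≡-Reasoning

    riordan-closed-form : ∀ ℓ m → riordan d h (ℓ ℕ.+ m) ℓ ≡ + (a ^ ℓ ℕ.* Q m (2 ℕ.* ℓ ℕ.+ 2))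
    riordan-closed-form ℓ m = begin
      (d ⊛ pow h ℓ) (ℓ ℕ.+ m)
        ≡⟨ ⊛≡conv d (pow h ℓ) (ℓ ℕ.+ m) ⟩
      conv d (pow h ℓ) (ℓ ℕ.+ m)
        ≡⟨ conv-cong (ℓ ℕ.+ m) (λ _ → refl) (pow-h ℓ) ⟩
      conv d (shift ℓ (scaledPow ℓ)) (ℓ ℕ.+ m)
        ≡⟨ conv-shift ℓ (ℓ ℕ.+ m) d (scaledPow ℓ) ⟩
      shift ℓ (conv d (scaledPow ℓ)) (ℓ ℕ.+ m)
        ≡⟨ shift-+ ℓ m _ ⟩
      conv d (scaledPow ℓ) m
        ≡⟨ conv-cong m d-expand (λ _ → refl) ⟩
      conv (λ i → pow S 2 i + + a * pow S 3 i) (scaledPow ℓ) m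
        ≡⟨ conv-distribʳ-+ m (pow S 2) (λ i → + a * pow S 3 i) (scaledPow ℓ) ⟩
      conv (pow S 2) (scaledPow ℓ) m + conv (λ i → + a * pow S 3 i) (scaledPow ℓ) m
        ≡⟨ cong₂ _+_ (conv-*ʳ m (+ (a ^ ℓ)) (pow S 2) _)
                     (trans (conv-*ˡ m (+ a) (pow S 3) (scaledPow ℓ)) (cong (+ a *_) (conv-*ʳ m (+ (a ^ ℓ)) (pow S 3) _))) ⟩
      + (a ^ ℓ) * conv (pow S 2) (pow S (ℓ ℕ.+ ℓ)) m + + a * (+ (a ^ ℓ) * conv (pow S 3) (pow S (ℓ ℕ.+ ℓ)) m)
        ≡⟨ cong₂ (λ u v → + (a ^ ℓ) * u + + a * (+ (a ^ ℓ) * v))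
                 (trans (sym (pow-conv 2 (ℓ ℕ.+ ℓ) m)) (pow≡P m _)) (trans (sym (pow-conv 3 (ℓ ℕ.+ ℓ) m)) (pow≡P m _)) ⟩
      + (a ^ ℓ) * + P m k + + a * (+ (a ^ ℓ) * + P m (suc k))
        ≡⟨ factor (+ (a ^ ℓ)) (+ a) _ _ ⟩
      + (a ^ ℓ) * (+ P m k + + a * + P m (suc k))
        ≡⟨ cong (λ z → + (a ^ ℓ) * (+ P m k + z)) (pos-* a _) ⟨
      + (a ^ ℓ) * (+ P m k + + (a ℕ.* P m (suc k)))
        ≡⟨ cong (+ (a ^ ℓ) *_) (pos-+ (P m k) _) ⟨
      + (a ^ ℓ) * + Q m k
        ≡⟨ pos-* (a ^ ℓ) (Q m k) ⟨
      + (a ^ ℓ ℕ.* Q m k)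
        ≡⟨ cong (λ k → + (a ^ ℓ ℕ.* Q m k)) (index ℓ) ⟩
      + (a ^ ℓ ℕ.* Q m (2 ℕ.* ℓ ℕ.+ 2))
        ∎
      where
      open ≡-Reasoning
      k = 2 ℕ.+ (ℓ ℕ.+ ℓ)
      factor : ∀ p q x y → p * x + q * (p * y) ≡ p * (x + q * y)
      factor = solve-∀
      index : ∀ ℓ → 2 ℕ.+ (ℓ ℕ.+ ℓ) ≡ 2 ℕ.* ℓ ℕ.+ 2
      index = Data.Nat.Tactic.RingSolver.solve-∀
        where import Data.Nat.Tactic.RingSolver

module Binomial where

  open import Data.Nat using (ℕ; zero; suc; _+_; _*_; _!; NonZero; >-nonZero; s≤s; z≤n)
  open import Data.Nat.Properties
  open import Data.Nat.Combinatorics using (_C_; nCk+nC[k+1]≡[n+1]C[k+1])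
  open import Data.Nat.Tactic.RingSolver using (solve-∀)
  open import Relation.Binary.PropositionalEquality

  binom : ℕ → ℕ → ℕ
  binom _       zero    = 1
  binom zero    (suc k) = 0
  binom (suc n) (suc k) = binom n k + binom n (suc k)

  binom≡C : ∀ n k → binom n k ≡ n C k
  binom≡C n       zero    = refl
  binom≡C zero    (suc k) = refl
  binom≡C (suc n) (suc k) = trans (cong₂ _+_ (binom≡C n k) (binom≡C n (suc k))) (nCk+nC[k+1]≡[n+1]C[k+1] n k)

  binom-over : ∀ n d → binom n (suc n + d) ≡ 0
  binom-over zero    d = refl
  binom-over (suc n) d = cong₂ _+_ (binom-over n d) (trans (cong (binom n) (sym (+-suc (suc n) d))) (binom-over n (suc d)))

  binom-absorb : ∀ n k → suc k * binom (suc n) (suc k) ≡ suc n * binom n k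
  binom-absorb zero    zero    = refl
  binom-absorb zero    (suc k) = *-zeroʳ (suc (suc k))
  binom-absorb (suc n) zero    = begin
    1 * (1 + binom (suc n) 1)  ≡⟨ *-identityˡ _ ⟩
    1 + binom (suc n) 1        ≡⟨ cong suc (trans (sym (*-identityˡ _)) (binom-absorb n 0)) ⟩
    1 + suc n * 1              ≡⟨ cong suc (*-identityʳ (suc n)) ⟩
    suc (suc n)                ≡⟨ *-identityʳ (suc (suc n)) ⟨
    suc (suc n) * 1            ∎
    where open ≡-Reasoning
  binom-absorb (suc n) (suc k) = begin
    suc (suc k) * (c + binom (suc n) (suc (suc k)))
      ≡⟨ expand (suc k) c _ ⟩
    c + suc k * c + suc (suc k) * binom (suc n) (suc (suc k))
      ≡⟨ cong₂ (λ u v → c + u + v) (binom-absorb n k) (binom-absorb n (suc k)) ⟩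
    c + suc n * binom n k + suc n * binom n (suc k)
      ≡⟨ +-assoc c _ _ ⟩
    c + (suc n * binom n k + suc n * binom n (suc k))
      ≡⟨ cong (c +_) (*-distribˡ-+ (suc n) (binom n k) _) ⟨
    suc (suc n) * c
      ∎
    where
    open ≡-Reasoning
    c = binom (suc n) (suc k)
    expand : ∀ k c x → suc k * (c + x) ≡ c + k * c + suc k * x
    expand = solve-∀

  binom-suc-ratio : ∀ i q → suc i * binom (i + suc q) (suc i) ≡ suc q * binom (i + suc q) i
  binom-suc-ratio i q = +-cancelˡ-≡ (suc i * binom N i) _ _ (begin
    suc i * binom N i + suc i * binom N (suc i)  ≡⟨ *-distribˡ-+ (suc i) (binom N i) _ ⟨
    suc i * binom (suc N) (suc i)                ≡⟨ binom-absorb N i ⟩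
    (suc i + suc q) * binom N i                  ≡⟨ *-distribʳ-+ (binom N i) (suc i) (suc q) ⟩
    suc i * binom N i + suc q * binom N i        ∎)
    where
    open ≡-Reasoning
    N = i + suc q

  binom-factorials : ∀ p q → binom (p + q) p * (p ! * q !) ≡ (p + q) !
  binom-factorials zero    q = trans (*-identityˡ _) (*-identityˡ _)
  binom-factorials (suc p) q = begin
    binom (suc (p + q)) (suc p) * (suc p * p ! * q !)
      ≡⟨ regroup (binom (suc (p + q)) (suc p)) (suc p) (p !) (q !) ⟩
    suc p * binom (suc (p + q)) (suc p) * (p ! * q !)
      ≡⟨ cong (_* (p ! * q !)) (binom-absorb (p + q) p) ⟩
    suc (p + q) * binom (p + q) p * (p ! * q !)
      ≡⟨ *-assoc (suc (p + q)) (binom (p + q) p) (p ! * q !) ⟩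
    suc (p + q) * (binom (p + q) p * (p ! * q !))
      ≡⟨ cong (suc (p + q) *_) (binom-factorials p q) ⟩
    suc (p + q) * (p + q) !
      ∎
    where
    open ≡-Reasoning
    regroup : ∀ b s x y → b * (s * x * y) ≡ s * b * (x * y)
    regroup = solve-∀

  -- The ballot numbers k / (k + 2i) · binom (k + 2i) i, defined by the recursion of the lattice paths
  -- they count.
  ballot : ℕ → ℕ → ℕ
  ballot k       zero    = 1
  ballot zero    (suc i) = 0
  ballot (suc k) (suc i) = ballot k (suc i) + ballot (suc (suc k)) i

  ballot≡binom : ∀ k i → k * binom (k + (i + i)) i ≡ (k + (i + i)) * ballot k i
  ballot≡binom k       zero    = cong (_* 1) (sym (+-identityʳ k))
  ballot≡binom zero    (suc i) = sym (*-zeroʳ (suc (i + suc i)))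
  ballot≡binom (suc k) (suc i) = *-cancelˡ-≡ _ _ W {{W≢0}} (begin
    W * (suc k * (Y + X))
      ≡⟨ s₁ k i n X Y ⟩
    n * suc k * (suc i * Y + suc i * X)
      ≡⟨ cong (λ z → n * suc k * (suc i * Y + z)) ratio ⟩
    n * suc k * (suc i * Y + K * Y)
      ≡⟨ s₂ k i Y ⟩
    suc n * (k * (K * Y) + suc (suc k) * suc i * Y)
      ≡⟨ cong (λ z → suc n * (k * z + suc (suc k) * suc i * Y)) ratio ⟨
    suc n * (k * (suc i * X) + suc (suc k) * suc i * Y)
      ≡⟨ s₃ i n k X Y ⟩
    suc i * suc n * (k * X + suc (suc k) * Y)
      ≡⟨ cong₂ (λ u v → suc i * suc n * (u + v)) (ballot≡binom k (suc i)) shifted ⟩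
    suc i * suc n * (n * ballot k (suc i) + n * ballot (suc (suc k)) i)
      ≡⟨ s₄ i n (ballot k (suc i)) (ballot (suc (suc k)) i) ⟩
    W * (suc n * (ballot k (suc i) + ballot (suc (suc k)) i))
      ∎)
    where
    open ≡-Reasoning
    n = k + (suc i + suc i)
    X = binom n (suc i)
    Y = binom n i
    K = suc (suc (k + i))
    W = suc i * n
    W≢0 : NonZero W
    W≢0 = m*n≢0 (suc i) n {{_}} {{>-nonZero (≤-trans (s≤s z≤n) (m≤n+m (suc i + suc i) k))}}
    n≡i+K : ∀ i k → i + suc (suc (k + i)) ≡ k + (suc i + suc i)
    n≡i+K = solve-∀
    n≡k+2+2i : ∀ i k → suc (suc k) + (i + i) ≡ k + (suc i + suc i)
    n≡k+2+2i = solve-∀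
    shifted : suc (suc k) * Y ≡ n * ballot (suc (suc k)) i
    shifted = trans (cong (λ z → suc (suc k) * binom z i) (sym (n≡k+2+2i i k)))
                    (trans (ballot≡binom (suc (suc k)) i) (cong (_* ballot (suc (suc k)) i) (n≡k+2+2i i k)))
    ratio : suc i * X ≡ K * Y
    ratio = trans (cong (λ z → suc i * binom z (suc i)) (sym (n≡i+K i k)))
                  (trans (binom-suc-ratio i (suc (k + i))) (cong (λ z → K * binom z i) (n≡i+K i k)))
    s₁ : ∀ k i n X Y → (suc i * n) * (suc k * (Y + X)) ≡ n * suc k * (suc i * Y + suc i * X)
    s₁ = solve-∀
    s₂ : ∀ k i Y → (k + (suc i + suc i)) * suc k * (suc i * Y + suc (suc (k + i)) * Y)
                 ≡ suc (k + (suc i + suc i)) * (k * (suc (suc (k + i)) * Y) + suc (suc k) * suc i * Y)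
    s₂ = solve-∀
    s₃ : ∀ i n k X Y → suc n * (k * (suc i * X) + suc (suc k) * suc i * Y) ≡ suc i * suc n * (k * X + suc (suc k) * Y)
    s₃ = solve-∀
    s₄ : ∀ i n b₁ b₂ → suc i * suc n * (n * b₁ + n * b₂) ≡ (suc i * n) * (suc n * (b₁ + b₂))
    s₄ = solve-∀

module ExplicitFormula where

  open import Defs using (ℕ→ℚ; sumℚ; formulaTerm; formula)
  open import Data.Nat as ℕ using (ℕ; zero; suc; _+_; _*_; _∸_; _^_; _≤_; _<_; z≤n; s≤s; _!; pred; NonZero)
  open import Data.Nat.Properties
  open import Data.Nat.Combinatorics using (_C_)
  open import Data.Nat.Tactic.RingSolver using (solve-∀)
  open import Data.Integer as ℤ using (ℤ; +_)
  import Data.Integer.Properties as ℤ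
  open import Data.Rational as ℚ using (ℚ; _/_; toℚᵘ)
  import Data.Rational.Properties as ℚ
  open import Data.Rational.Unnormalised as ℚᵘ using (ℚᵘ; mkℚᵘ; *≡*)
  import Data.Rational.Unnormalised.Properties as ℚᵘ
  open import Data.List using (List; map; upTo; applyUpTo)
  open import Data.List.Properties using (map-upTo)
  open import Data.Product using (_,_)
  open import Function using (_∘_)
  open import Relation.Binary.PropositionalEquality
  open FiniteSums
  open Binomial

  binom∸ : ℕ → ℕ → ℕ → ℕ
  binom∸ n m zero = binom n m
  binom∸ n zero (suc i) = 0
  binom∸ n (suc m) (suc i) = binom∸ n m i

  binom∸-pascal : ∀ n m i → binom∸ (suc n) (suc m) i ≡ binom∸ n (suc m) i + binom∸ n m i
  binom∸-pascal n m zero = +-comm (binom n m) (binom n (suc m))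
  binom∸-pascal n zero (suc zero) = refl
  binom∸-pascal n zero (suc (suc i)) = refl
  binom∸-pascal n (suc m) (suc i) = binom∸-pascal n m i

  binom∸-over : ∀ n s → binom∸ n s (suc s) ≡ 0
  binom∸-over n zero = refl
  binom∸-over n (suc s) = binom∸-over n s

  binom∸-+ : ∀ n j i → binom∸ n (j + i) i ≡ binom n j
  binom∸-+ n j zero = cong (binom n) (+-identityʳ j)
  binom∸-+ n j (suc i) = trans (cong (λ z → binom∸ n z (suc i)) (+-suc j i)) (binom∸-+ n j i)

  -- P m k = ∑ᵢ binom (m + k + i − 1) (m − i) · ballot k i · aⁱ, where binom∸ n m i = binom n (m − i)
  -- for i ≤ m and 0 for i > m.
  PTerm : ℕ → ℕ → ℕ → ℕ
  PTerm m k i = binom∸ (pred (m + k + i)) m i * ballot k i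

  module ExplicitP (a : ℕ) where
    open Coefficients a

    PSum : ℕ → ℕ → ℕ
    PSum m k = ∑< (suc m) (λ i → PTerm m k i * a ^ i)

    PTerm-suc-suc : ∀ s k i → PTerm (suc s) (suc k) i ≡ binom∸ (suc (s + k + i)) (suc s) i * ballot (suc k) i
    PTerm-suc-suc s k i = cong (λ z → binom∸ z (suc s) i * ballot (suc k) i) (cong pred (index s k i))
      where index : ∀ s k i → suc s + suc k + i ≡ suc (suc (s + k + i))
            index = solve-∀
    PTerm-sucʳ : ∀ s k i → PTerm s (suc k) i ≡ binom∸ (s + k + i) s i * ballot (suc k) i
    PTerm-sucʳ s k i = cong (λ z → binom∸ z s i * ballot (suc k) i) (cong pred (index s k i))
      where index : ∀ s k i → s + suc k + i ≡ suc (s + k + i)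
            index = solve-∀
    PTerm-sucʳ-sucʳ : ∀ s k i → PTerm s (suc (suc k)) i ≡ binom∸ (s + k + suc i) s i * ballot (suc (suc k)) i
    PTerm-sucʳ-sucʳ s k i = cong (λ z → binom∸ z s i * ballot (suc (suc k)) i) (cong pred (index s k i))
      where index : ∀ s k i → s + suc (suc k) + i ≡ suc (s + k + suc i)
            index = solve-∀

    shiftedTerm : ℕ → ℕ → ℕ → ℕ
    shiftedTerm s k zero = 0
    shiftedTerm s k (suc i) = a * (PTerm s (suc (suc k)) i * a ^ i)

    PTerm-pascal : ∀ s k i → PTerm (suc s) (suc k) i * a ^ i ≡ PTerm (suc s) k i * a ^ i + PTerm s (suc k) i * a ^ i + shiftedTerm s k i
    PTerm-pascal s k zero = begin
        PTerm (suc s) (suc k) 0 * 1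
      ≡⟨ cong (_* 1) (trans (PTerm-suc-suc s k 0) (cong (_* 1) (binom∸-pascal (s + k + 0) s 0))) ⟩
        (binom∸ (s + k + 0) (suc s) 0 + binom∸ (s + k + 0) s 0) * 1 * 1
      ≡⟨ distribute (binom∸ (s + k + 0) (suc s) 0) (binom∸ (s + k + 0) s 0) ⟩
        binom∸ (s + k + 0) (suc s) 0 * 1 * 1 + binom∸ (s + k + 0) s 0 * 1 * 1 + 0
      ≡⟨ cong (λ z → binom∸ (s + k + 0) (suc s) 0 * 1 * 1 + z * 1 + 0) (sym (PTerm-sucʳ s k 0)) ⟩
        PTerm (suc s) k 0 * 1 + PTerm s (suc k) 0 * 1 + 0 ∎
      where
      open ≡-Reasoning
      distribute : ∀ x y → (x + y) * 1 * 1 ≡ x * 1 * 1 + y * 1 * 1 + 0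
      distribute = solve-∀
    PTerm-pascal s k (suc i) = begin
        PTerm (suc s) (suc k) (suc i) * a ^ suc i
      ≡⟨ cong (_* a ^ suc i) (trans (PTerm-suc-suc s k (suc i)) (cong (_* ballot (suc k) (suc i)) (binom∸-pascal (s + k + suc i) s (suc i)))) ⟩
        (D₁ + D₀) * (ballot k (suc i) + ballot (suc (suc k)) i) * (a * a ^ i)
      ≡⟨ distribute a (a ^ i) D₁ D₀ (ballot k (suc i)) (ballot (suc (suc k)) i) ⟩
        D₁ * ballot k (suc i) * (a * a ^ i) + D₀ * (ballot k (suc i) + ballot (suc (suc k)) i) * (a * a ^ i) + a * (D₀′ * ballot (suc (suc k)) i * a ^ i)
      ≡⟨ cong₂ (λ u v → D₁ * ballot k (suc i) * (a * a ^ i) + u * (a * a ^ i) + a * (v * a ^ i)) (sym (PTerm-sucʳ s k (suc i))) (sym (PTerm-sucʳ-sucʳ s k i)) ⟩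
        PTerm (suc s) k (suc i) * a ^ suc i + PTerm s (suc k) (suc i) * a ^ suc i + shiftedTerm s k (suc i) ∎
      where
      open ≡-Reasoning
      D₁ = binom∸ (s + k + suc i) (suc s) (suc i)
      D₀ = binom∸ (s + k + suc i) s (suc i)
      D₀′ = binom∸ (s + k + suc i) s i
      distribute : ∀ a p x y u v → (x + y) * (u + v) * (a * p) ≡ x * u * (a * p) + y * (u + v) * (a * p) + a * (x * v * p)
      distribute = solve-∀

    PSum≡P : ∀ m k → PSum m k ≡ P m k
    PSum≡P zero k = refl
    PSum≡P (suc s) zero = ∑<-zero (suc (suc s)) _ z
      where
      z : ∀ i → i < suc (suc s) → PTerm (suc s) 0 i * a ^ i ≡ 0
      z zero _ = cong (λ x → x * 1 * 1) (trans (cong (λ w → binom w (suc s)) (trans (+-identityʳ _) (+-identityʳ s))) (trans (cong (binom s) (sym (+-identityʳ (suc s)))) (binom-over s 0)))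
      z (suc i) _ = cong (_* a ^ suc i) (*-zeroʳ (binom∸ (pred (suc s + 0 + suc i)) (suc s) (suc i)))
    PSum≡P (suc s) (suc k) = begin
        PSum (suc s) (suc k)
      ≡⟨ ∑<-cong (suc (suc s)) (λ i _ → PTerm-pascal s k i) ⟩
        ∑< (suc (suc s)) (λ i → PTerm (suc s) k i * a ^ i + PTerm s (suc k) i * a ^ i + shiftedTerm s k i)
      ≡⟨ trans (∑<-+ (suc (suc s)) (λ i → PTerm (suc s) k i * a ^ i + PTerm s (suc k) i * a ^ i) (shiftedTerm s k)) (cong (_+ ∑< (suc (suc s)) (shiftedTerm s k)) (∑<-+ (suc (suc s)) (λ i → PTerm (suc s) k i * a ^ i) (λ i → PTerm s (suc k) i * a ^ i))) ⟩
        PSum (suc s) k + ∑< (suc (suc s)) (λ i → PTerm s (suc k) i * a ^ i) + ∑< (suc (suc s)) (shiftedTerm s k)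
      ≡⟨ cong₂ (λ u v → PSum (suc s) k + u + v) last-vanishes shifted-sum ⟩
        PSum (suc s) k + PSum s (suc k) + a * PSum s (suc (suc k))
      ≡⟨ cong₂ (λ u v → u + v + a * PSum s (suc (suc k))) (PSum≡P (suc s) k) (PSum≡P s (suc k)) ⟩
        P (suc s) k + P s (suc k) + a * PSum s (suc (suc k))
      ≡⟨ cong (λ z → P (suc s) k + P s (suc k) + a * z) (PSum≡P s (suc (suc k))) ⟩
        P (suc s) (suc k) ∎
      where
      open ≡-Reasoning
      last-vanishes : ∑< (suc (suc s)) (λ i → PTerm s (suc k) i * a ^ i) ≡ PSum s (suc k)
      last-vanishes = trans (∑<-last (suc s) (λ i → PTerm s (suc k) i * a ^ i))
             (trans (cong (λ z → ∑< (suc s) (λ i → PTerm s (suc k) i * a ^ i) + z * ballot (suc k) (suc s) * a ^ suc s) (binom∸-over (pred (s + suc k + suc s)) s)) (+-identityʳ _))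
      shifted-sum : ∑< (suc (suc s)) (shiftedTerm s k) ≡ a * PSum s (suc (suc k))
      shifted-sum = ∑<-*ˡ (suc s) a (λ i → PTerm s (suc (suc k)) i * a ^ i)

  binom-ballot-factorials : ∀ j i k' → suc (j + (k' + (i + i))) * (binom (j + (k' + (i + i))) j * ballot (suc k') i)
                     ≡ binom (j + i) j * (suc k' * binom (suc (j + (k' + (i + i)))) (j + i))
  binom-ballot-factorials j i k' = *-cancelˡ-≡ _ _ W {{W≢0}} (begin
      W * (N * (bM * Bk))
    ≡⟨ s₁ T (j !) F' (i !) Fk N bM Bk ⟩
      N * (bM * (j ! * F')) * ((T * Bk) * (i ! * Fk))
    ≡⟨ cong₂ (λ u v → N * u * (v * (i ! * Fk))) (binom-factorials j (k' + (i + i))) (sym (ballot≡binom k i)) ⟩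
      N * M ! * ((k * binom T i) * (i ! * Fk))
    ≡⟨ s₂ N (M !) k (binom T i) (i ! * Fk) ⟩
      N * M ! * k * (binom T i * (i ! * Fk))
    ≡⟨ cong (λ z → N * M ! * k * z) factorials-T ⟩
      N * M ! * k * T !
    ≡⟨ sym (s₃ k (N * M !) (T !)) ⟩
      k * N ! * T !
    ≡⟨ cong (λ z → k * z * T !) (sym factorials-N) ⟩
      k * (binom N (j + i) * ((j + i) ! * Fk)) * (T * F')
    ≡⟨ cong (λ z → k * (binom N (j + i) * (z * Fk)) * (T * F')) (sym (binom-factorials j i)) ⟩
      k * (binom N (j + i) * ((binom (j + i) j * (j ! * i !)) * Fk)) * (T * F')
    ≡⟨ s₄ T (j !) F' (i !) Fk k (binom N (j + i)) (binom (j + i) j) ⟩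
      W * (binom (j + i) j * (k * binom N (j + i))) ∎)
    where
    open ≡-Reasoning
    k = suc k'
    M = j + (k' + (i + i))
    N = suc M
    T = k + (i + i)
    F' = (k' + (i + i)) !
    Fk = (k + i) !
    bM = binom M j
    Bk = ballot k i
    W = T * ((j ! * F') * (i ! * Fk))
    W≢0 : NonZero W
    W≢0 = m*n≢0 T _ {{_}} {{m*n≢0 _ _ {{m*n≢0 _ _ {{j !≢0}} {{(k' + (i + i)) !≢0}}}} {{m*n≢0 _ _ {{i !≢0}} {{(k + i) !≢0}}}}}}
    T≡ : ∀ i k → i + (k + i) ≡ k + (i + i)
    T≡ = solve-∀
    factorials-T : binom T i * (i ! * Fk) ≡ T !
    factorials-T = trans (cong (λ z → binom z i * (i ! * Fk)) (sym (T≡ i k))) (trans (binom-factorials i (k + i)) (cong _! (T≡ i k)))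
    N≡ : ∀ j i k' → j + i + (suc k' + i) ≡ suc (j + (k' + (i + i)))
    N≡ = solve-∀
    factorials-N : binom N (j + i) * ((j + i) ! * Fk) ≡ N !
    factorials-N = trans (cong (λ z → binom z (j + i) * ((j + i) ! * Fk)) (sym (N≡ j i k'))) (trans (binom-factorials (j + i) (k + i)) (cong _! (N≡ j i k')))
    s₁ : ∀ T jf F' i! Fk N bM Bk → T * ((jf * F') * (i! * Fk)) * (N * (bM * Bk)) ≡ N * (bM * (jf * F')) * ((T * Bk) * (i! * Fk))
    s₁ = solve-∀
    s₂ : ∀ N Mf k b x → N * Mf * ((k * b) * x) ≡ N * Mf * k * (b * x)
    s₂ = solve-∀
    s₃ : ∀ k NM Tf → k * NM * Tf ≡ NM * k * Tf
    s₃ = solve-∀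
    s₄ : ∀ T jf F' i! Fk k bN bji → k * (bN * ((bji * (jf * i!)) * Fk)) * (T * F') ≡ T * ((jf * F') * (i! * Fk)) * (bji * (k * bN))
    s₄ = solve-∀

  PTerm-binomials : ∀ j i k' → suc (j + (k' + (i + i))) * PTerm (j + i) (suc k') i ≡ binom (j + i) j * (suc k' * binom (suc (j + (k' + (i + i)))) (j + i))
  PTerm-binomials j i k' = trans (cong (λ z → suc (j + (k' + (i + i))) * (z * ballot (suc k') i))
                      (trans (cong (λ w → binom∸ w (j + i) i) (cong pred (index j i k'))) (binom∸-+ _ j i)))
                    (binom-ballot-factorials j i k')
    where
    index : ∀ j i k' → j + i + suc k' + i ≡ suc (j + (k' + (i + i)))
    index = solve-∀

  toℚᵘ-/ : ∀ x d → toℚᵘ (+ x / suc d) ℚᵘ.≃ mkℚᵘ (+ x) d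
  toℚᵘ-/ x d = ℚ.toℚᵘ-fromℚᵘ (mkℚᵘ (+ x) d)

  ℕ→ℚ-+ : ∀ x y → ℕ→ℚ (x ℕ.+ y) ≡ ℕ→ℚ x ℚ.+ ℕ→ℚ y
  ℕ→ℚ-+ x y = ℚ.toℚᵘ-injective (ℚᵘ.≃-trans (toℚᵘ-/ (x ℕ.+ y) 0) (ℚᵘ.≃-trans cross (ℚᵘ.≃-sym (ℚᵘ.≃-trans (ℚ.toℚᵘ-homo-+ (ℕ→ℚ x) (ℕ→ℚ y)) (ℚᵘ.+-cong (toℚᵘ-/ x 0) (toℚᵘ-/ y 0))))))
    where
    cross : mkℚᵘ (+ (x ℕ.+ y)) 0 ℚᵘ.≃ (mkℚᵘ (+ x) 0 ℚᵘ.+ mkℚᵘ (+ y) 0)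
    cross = *≡* (trans (ℤ.*-identityʳ (+ (x ℕ.+ y))) (trans (ℤ.pos-+ x y) (sym (trans (ℤ.*-identityʳ _) (cong₂ ℤ._+_ (ℤ.*-identityʳ (+ x)) (ℤ.*-identityʳ (+ y)))))))

  ℕ→ℚ-* : ∀ x y → ℕ→ℚ (x ℕ.* y) ≡ ℕ→ℚ x ℚ.* ℕ→ℚ y
  ℕ→ℚ-* x y = ℚ.toℚᵘ-injective (ℚᵘ.≃-trans (toℚᵘ-/ (x ℕ.* y) 0) (ℚᵘ.≃-trans cross (ℚᵘ.≃-sym (ℚᵘ.≃-trans (ℚ.toℚᵘ-homo-* (ℕ→ℚ x) (ℕ→ℚ y)) (ℚᵘ.*-cong (toℚᵘ-/ x 0) (toℚᵘ-/ y 0))))))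
    where
    cross : mkℚᵘ (+ (x ℕ.* y)) 0 ℚᵘ.≃ (mkℚᵘ (+ x) 0 ℚᵘ.* mkℚᵘ (+ y) 0)
    cross = *≡* (cong (ℤ._* + 1) (ℤ.pos-* x y))

  ℕ→ℚ-*-/ : ∀ c X N y → c ℕ.* X ≡ suc N ℕ.* y → ℕ→ℚ c ℚ.* (+ X / suc N) ≡ ℕ→ℚ y
  ℕ→ℚ-*-/ c X N y eq = ℚ.toℚᵘ-injective (ℚᵘ.≃-trans (ℚ.toℚᵘ-homo-* (ℕ→ℚ c) (+ X / suc N)) (ℚᵘ.≃-trans (ℚᵘ.*-cong (toℚᵘ-/ c 0) (toℚᵘ-/ X N)) (ℚᵘ.≃-trans cross (ℚᵘ.≃-sym (toℚᵘ-/ y 0)))))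
    where
    cross : (mkℚᵘ (+ c) 0 ℚᵘ.* mkℚᵘ (+ X) N) ℚᵘ.≃ mkℚᵘ (+ y) 0
    cross = *≡* (trans (ℤ.*-identityʳ _) (trans (sym (ℤ.pos-* c X)) (trans (cong +_ eq) (trans (ℤ.pos-* (suc N) y) (trans (ℤ.*-comm (+ suc N) (+ y)) (cong (λ z → + y ℤ.* + z) (sym (*-identityˡ (suc N)))))))))

  sumℚ-cong : ∀ n {f g : ℕ → ℚ} → (∀ t → t < n → f t ≡ g t) → sumℚ (applyUpTo f n) ≡ sumℚ (applyUpTo g n)
  sumℚ-cong zero    eq = refl
  sumℚ-cong (suc n) eq = cong₂ ℚ._+_ (eq 0 (s≤s z≤n)) (sumℚ-cong n (λ t t<n → eq (suc t) (s≤s t<n)))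

  sumℚ-ℕ→ℚ : ∀ n (g : ℕ → ℕ) → sumℚ (applyUpTo (λ t → ℕ→ℚ (g t)) n) ≡ ℕ→ℚ (∑< n g)
  sumℚ-ℕ→ℚ zero    g = refl
  sumℚ-ℕ→ℚ (suc n) g = trans (cong (ℕ→ℚ (g 0) ℚ.+_) (sumℚ-ℕ→ℚ n (g ∘ suc))) (sym (ℕ→ℚ-+ (g 0) _))

  PTerm-binomials-C : ∀ j i k k' N → k ≡ suc k' → N ≡ suc (j + (k' + (i + i))) → ((j + i) C j) * (k * (N C (j + i))) ≡ N * PTerm (j + i) k i
  PTerm-binomials-C j i k k' N refl refl
    rewrite sym (binom≡C (j + i) j) | sym (binom≡C (suc (j + (k' + (i + i)))) (j + i)) = sym (PTerm-binomials j i k')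

  module FormulaTerms (a : ℕ) where
    open ExplicitP a
    open Coefficients a

    -- formulaTerm (a + 1) n ℓ j is definitionally formulaTerm′ ℓ (n ∸ ℓ) (2n ∸ j) (n ∸ j) j.
    formulaTerm′ : ℕ → ℕ → ℕ → ℕ → ℕ → ℚ
    formulaTerm′ ℓ m' D pw j = ℕ→ℚ (m' C j) ℚ.* ((+ ((2 * ℓ + 2) * (suc (suc D) C m')) / suc (suc D))
                        ℚ.+ (+ ((2 * ℓ + 3) * a * (suc (suc (suc D)) C m')) / suc (suc (suc D)))) ℚ.* ℕ→ℚ (a ^ pw)

    formulaTerm′≡PTerms : ∀ ℓ j i → formulaTerm′ ℓ (j + i) (j + (2 * ℓ + (i + i))) (ℓ + i) j ≡ ℕ→ℚ ((PTerm (j + i) (2 * ℓ + 2) i + a * PTerm (j + i) (2 * ℓ + 3) i) * a ^ (ℓ + i))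
    formulaTerm′≡PTerms ℓ j i = begin
        ℕ→ℚ c ℚ.* ((+ X₁ / suc (suc D)) ℚ.+ (+ X₂ / suc (suc (suc D)))) ℚ.* ℕ→ℚ (a ^ (ℓ + i))
      ≡⟨ cong (ℚ._* ℕ→ℚ (a ^ (ℓ + i))) (ℚ.*-distribˡ-+ (ℕ→ℚ c) (+ X₁ / suc (suc D)) (+ X₂ / suc (suc (suc D)))) ⟩
        (ℕ→ℚ c ℚ.* (+ X₁ / suc (suc D)) ℚ.+ ℕ→ℚ c ℚ.* (+ X₂ / suc (suc (suc D)))) ℚ.* ℕ→ℚ (a ^ (ℓ + i))
      ≡⟨ cong (ℚ._* ℕ→ℚ (a ^ (ℓ + i))) (cong₂ ℚ._+_ (ℕ→ℚ-*-/ c X₁ (suc D) y₁ first-term) (ℕ→ℚ-*-/ c X₂ (suc (suc D)) y₂ second-term)) ⟩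
        (ℕ→ℚ y₁ ℚ.+ ℕ→ℚ y₂) ℚ.* ℕ→ℚ (a ^ (ℓ + i))
      ≡⟨ cong (ℚ._* ℕ→ℚ (a ^ (ℓ + i))) (sym (ℕ→ℚ-+ y₁ y₂)) ⟩
        ℕ→ℚ (y₁ + y₂) ℚ.* ℕ→ℚ (a ^ (ℓ + i))
      ≡⟨ sym (ℕ→ℚ-* (y₁ + y₂) _) ⟩
        ℕ→ℚ ((y₁ + y₂) * a ^ (ℓ + i)) ∎
      where
      open ≡-Reasoning
      D = j + (2 * ℓ + (i + i))
      c = (j + i) C j
      X₁ = (2 * ℓ + 2) * (suc (suc D) C (j + i))
      X₂ = (2 * ℓ + 3) * a * (suc (suc (suc D)) C (j + i))
      y₁ = PTerm (j + i) (2 * ℓ + 2) i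
      y₂ = a * PTerm (j + i) (2 * ℓ + 3) i
      k₁≡ : ∀ ℓ → 2 * ℓ + 2 ≡ suc (suc (2 * ℓ))
      k₁≡ = solve-∀
      k₂≡ : ∀ ℓ → 2 * ℓ + 3 ≡ suc (suc (suc (2 * ℓ)))
      k₂≡ = solve-∀
      N₁≡ : ∀ j ℓ i → suc (suc (j + (2 * ℓ + (i + i)))) ≡ suc (j + (suc (2 * ℓ) + (i + i)))
      N₁≡ = solve-∀
      N₂≡ : ∀ j ℓ i → suc (suc (suc (j + (2 * ℓ + (i + i))))) ≡ suc (j + (suc (suc (2 * ℓ)) + (i + i)))
      N₂≡ = solve-∀
      first-term : c * X₁ ≡ suc (suc D) * y₁
      first-term = PTerm-binomials-C j i (2 * ℓ + 2) (suc (2 * ℓ)) (suc (suc D)) (k₁≡ ℓ) (N₁≡ j ℓ i)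
      scale : ∀ c k a C N y → c * (k * C) ≡ N * y → c * (k * a * C) ≡ N * (a * y)
      scale c k a C N y h = trans (pull-out c k a C) (trans (cong (a *_) h) (push-in a N y))
        where
        pull-out : ∀ c k a C → c * (k * a * C) ≡ a * (c * (k * C))
        pull-out = solve-∀
        push-in : ∀ a N y → a * (N * y) ≡ N * (a * y)
        push-in = solve-∀
      second-term : c * X₂ ≡ suc (suc (suc D)) * y₂
      second-term = scale c (2 * ℓ + 3) a (suc (suc (suc D)) C (j + i)) (suc (suc (suc D))) (PTerm (j + i) (2 * ℓ + 3) i)
               (PTerm-binomials-C j i (2 * ℓ + 3) (suc (suc (2 * ℓ))) (suc (suc (suc D))) (k₂≡ ℓ) (N₂≡ j ℓ i))

    PTerms : ℕ → ℕ → ℕ → ℕ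
    PTerms ℓ m j = (PTerm m (2 * ℓ + 2) (m ∸ j) + a * PTerm m (2 * ℓ + 3) (m ∸ j)) * a ^ (ℓ + (m ∸ j))

    formulaTerm≡PTerms : ∀ ℓ m j → j ≤ m → formulaTerm (suc a) (ℓ + m) ℓ j ≡ ℕ→ℚ (PTerms ℓ m j)
    formulaTerm≡PTerms ℓ m j le with m≤n⇒∃[o]m+o≡n le
    ... | i , refl = begin
        formulaTerm′ ℓ ((ℓ + (j + i)) ∸ ℓ) (2 * (ℓ + (j + i)) ∸ j) ((ℓ + (j + i)) ∸ j) j
      ≡⟨ cong₃ (formulaTerm′ ℓ) (m+n∸m≡n ℓ (j + i)) 2n∸j≡ n∸j≡ ⟩
        formulaTerm′ ℓ (j + i) (j + (2 * ℓ + (i + i))) (ℓ + i) j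
      ≡⟨ formulaTerm′≡PTerms ℓ j i ⟩
        ℕ→ℚ ((PTerm (j + i) (2 * ℓ + 2) i + a * PTerm (j + i) (2 * ℓ + 3) i) * a ^ (ℓ + i))
      ≡⟨ cong (λ z → ℕ→ℚ ((PTerm (j + i) (2 * ℓ + 2) z + a * PTerm (j + i) (2 * ℓ + 3) z) * a ^ (ℓ + z))) (sym (m+n∸m≡n j i)) ⟩
        ℕ→ℚ (PTerms ℓ (j + i) j) ∎
      where
      open ≡-Reasoning
      cong₃ : ∀ (f : ℕ → ℕ → ℕ → ℕ → ℚ) {x y z u v w} → x ≡ u → y ≡ v → z ≡ w → f x y z j ≡ f u v w j
      cong₃ f refl refl refl = refl
      2n≡ : ∀ ℓ j i → 2 * (ℓ + (j + i)) ≡ j + (j + (2 * ℓ + (i + i)))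
      2n≡ = solve-∀
      2n∸j≡ : 2 * (ℓ + (j + i)) ∸ j ≡ j + (2 * ℓ + (i + i))
      2n∸j≡ = trans (cong (_∸ j) (2n≡ ℓ j i)) (m+n∸m≡n j _)
      n≡ : ∀ ℓ j i → ℓ + (j + i) ≡ j + (ℓ + i)
      n≡ = solve-∀
      n∸j≡ : (ℓ + (j + i)) ∸ j ≡ ℓ + i
      n∸j≡ = trans (cong (_∸ j) (n≡ ℓ j i)) (m+n∸m≡n j _)

    distribute : ∀ a p index x y → (x + a * y) * (p * index) ≡ p * (x * index) + p * a * (y * index)
    distribute = solve-∀
    factor : ∀ p a u v → p * u + p * a * v ≡ p * (u + a * v)
    factor = solve-∀

    sum-PTerms : ∀ ℓ m → ∑< (suc m) (PTerms ℓ m) ≡ a ^ ℓ * (P m (2 * ℓ + 2) + a * P m (2 * ℓ + 3))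
    sum-PTerms ℓ m = begin
        ∑< (suc m) (PTerms ℓ m)
      ≡⟨ ∑<-reverse (suc m) (PTerms ℓ m) ⟩
        ∑< (suc m) (λ t → PTerms ℓ m (m ∸ t))
      ≡⟨ ∑<-cong (suc m) (λ t lt → trans (cong (λ z → (PTerm m (2 * ℓ + 2) z + a * PTerm m (2 * ℓ + 3) z) * a ^ (ℓ + z)) (m∸[m∸n]≡n (≤-pred lt)))
                                            (trans (cong (λ z → (PTerm m (2 * ℓ + 2) t + a * PTerm m (2 * ℓ + 3) t) * z) (^-distribˡ-+-* a ℓ t))
                                                   (distribute a (a ^ ℓ) (a ^ t) (PTerm m (2 * ℓ + 2) t) (PTerm m (2 * ℓ + 3) t)))) ⟩
        ∑< (suc m) (λ t → a ^ ℓ * (PTerm m (2 * ℓ + 2) t * a ^ t) + a ^ ℓ * a * (PTerm m (2 * ℓ + 3) t * a ^ t))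
      ≡⟨ trans (∑<-+ (suc m) (λ t → a ^ ℓ * (PTerm m (2 * ℓ + 2) t * a ^ t)) (λ t → a ^ ℓ * a * (PTerm m (2 * ℓ + 3) t * a ^ t)))
               (cong₂ _+_ (∑<-*ˡ (suc m) (a ^ ℓ) (λ t → PTerm m (2 * ℓ + 2) t * a ^ t)) (∑<-*ˡ (suc m) (a ^ ℓ * a) (λ t → PTerm m (2 * ℓ + 3) t * a ^ t))) ⟩
        a ^ ℓ * PSum m (2 * ℓ + 2) + a ^ ℓ * a * PSum m (2 * ℓ + 3)
      ≡⟨ factor (a ^ ℓ) a _ _ ⟩
        a ^ ℓ * (PSum m (2 * ℓ + 2) + a * PSum m (2 * ℓ + 3))
      ≡⟨ cong₂ (λ u v → a ^ ℓ * (u + a * v)) (PSum≡P m _) (PSum≡P m _) ⟩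
        a ^ ℓ * (P m (2 * ℓ + 2) + a * P m (2 * ℓ + 3)) ∎
      where open ≡-Reasoning

    formula-closed-form : ∀ ℓ m → formula (suc a) (ℓ + m) ℓ ≡ ℕ→ℚ (a ^ ℓ * Q m (2 * ℓ + 2))
    formula-closed-form ℓ m = begin
        sumℚ (map (formulaTerm (suc a) (ℓ + m) ℓ) (upTo (suc ((ℓ + m) ∸ ℓ))))
      ≡⟨ cong (λ z → sumℚ (map (formulaTerm (suc a) (ℓ + m) ℓ) (upTo (suc z)))) (m+n∸m≡n ℓ m) ⟩
        sumℚ (map (formulaTerm (suc a) (ℓ + m) ℓ) (upTo (suc m)))
      ≡⟨ cong sumℚ (map-upTo (formulaTerm (suc a) (ℓ + m) ℓ) (suc m)) ⟩
        sumℚ (applyUpTo (formulaTerm (suc a) (ℓ + m) ℓ) (suc m))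
      ≡⟨ sumℚ-cong (suc m) (λ j lt → formulaTerm≡PTerms ℓ m j (≤-pred lt)) ⟩
        sumℚ (applyUpTo (λ j → ℕ→ℚ (PTerms ℓ m j)) (suc m))
      ≡⟨ sumℚ-ℕ→ℚ (suc m) (PTerms ℓ m) ⟩
        ℕ→ℚ (∑< (suc m) (PTerms ℓ m))
      ≡⟨ cong ℕ→ℚ (sum-PTerms ℓ m) ⟩
        ℕ→ℚ (a ^ ℓ * (P m (2 * ℓ + 2) + a * P m (2 * ℓ + 3)))
      ≡⟨ cong (λ k → ℕ→ℚ (a ^ ℓ * (P m (2 * ℓ + 2) + a * P m k))) (+-suc (2 * ℓ) 2) ⟩
        ℕ→ℚ (a ^ ℓ * Q m (2 * ℓ + 2)) ∎
      where open ≡-Reasoning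

open import Defs
open import Data.Nat using (zero; suc; _+_; _≤_; s≤s)
open import Data.Nat.Properties using (m≤n⇒∃[o]m+o≡n; +-identityʳ; *-identityʳ)
open import Data.Integer using (+_)
open import Data.Product using (_×_; _,_)
open import Relation.Binary.PropositionalEquality using (_≡_; refl; cong; sym; trans)

open PowerSeries
open ExplicitFormula

for-ℓ≤n : {R : ℕ → ℕ → Set} → (∀ ℓ m → R (ℓ + m) ℓ) → ∀ n ℓ → ℓ ≤ n → R n ℓ
for-ℓ≤n closed n ℓ ℓ≤n with m≤n⇒∃[o]m+o≡n ℓ≤n
... | m , refl = closed ℓ m

theorem4p1 : (r : ℕ) → 2 ≤ r →
    ((n ℓ : ℕ) → ℓ ≤ n → ℕ→ℚ (U r n ℓ) ≡ formula r n ℓ)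
    × (U r 0 0 ≡ r)
    × ((S : PS) → IsSr r S → (n ℓ : ℕ) → ℓ ≤ n →
         + (U r n ℓ) ≡ riordan (pow S 2 ⊛ (const (+ 1) ⊕ (const (+ (r Data.Nat.∸ 1)) ⊛ S)))
                                (xmul (const (+ (r Data.Nat.∸ 1)) ⊛ pow S 2)) n ℓ)
theorem4p1 (suc zero)    (s≤s ())
theorem4p1 (suc (suc b)) _ =
  for-ℓ≤n (λ ℓ m → trans (cong ℕ→ℚ (U-closed-form ℓ m)) (sym (formula-closed-form ℓ m))) ,
  trans (U-closed-form 0 0) (cong suc (trans (+-identityʳ _) (*-identityʳ a))) ,
  λ S S-eq → for-ℓ≤n (λ ℓ m → trans (cong +_ (U-closed-form ℓ m)) (sym (PowersOfS.riordan-closed-form a S S-eq ℓ m)))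
  where
  a = suc b
  open Coefficients a
  open ColouredPaths a
  open FormulaTerms a
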